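{- For every closed term $M:\mathbb N\to\mathbb N$ of $T^{\mathtt R}$ there exist closed terms $F:\mathbb N\to\mathbb N\to\mathbb N\to\mathbf{BIN}$ and $Q:\mathbb N\to\mathbb N\to\mathbb N$ of Gödel's System T such that for all $m\in\mathbb N$ and all $n\ge1$: $\sum_{k\in\mathbb N}\bigl|[\![M\,\mathbf m]\!](\mathbf k)-\mathrm{val}(F\,\mathbf m\,\mathbf n\,\mathbf k)\bigr|\le\frac1n$, and $\mathrm{val}(F\,\mathbf m\,\mathbf n\,\mathbf k)=0$ for all $k\ge$ the normal form of $Q\,\mathbf m\,\mathbf n$.
   Context: Types: $\sigma,\tau::=\mathbb N\mid\sigma\to\tau\mid\sigma\times\tau$. $T^{\mathtt R}$ terms: $M,N::=x\mid\lambda x.M\mid M\,N\mid\langle M,N\rangle\mid\pi_1\mid\pi_2\mid\mathtt{rec}\mid\mathtt 0\mid\mathtt S\mid\mathtt R$, simply typed with $\mathtt 0:\mathbb N$, $\mathtt S:\mathbb N\to\mathbb N$, $\mathtt{rec}:(\sigma\times(\mathbb N\to\sigma\to\sigma)\times\mathbb N)\to\sigma$, $\pi_1:(\sigma\times\tau)\to\sigma$, $\pi_2:(\sigma\times\tau)\to\tau$, $\mathtt R:\mathbb N$. Gödel's System T is the fragment without $\mathtt R$. Numerals $\mathbf 0=\mathtt 0$, $\mathbf{n+1}=\mathtt S\mathbf n$. Values: closed terms of $V,W::=\lambda x.M\mid\pi_1\mid\pi_2\mid\langle V,W\rangle\mid\mathtt{rec}\mid\mathtt 0\mid\mathtt S\mid\mathtt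 S\,V$. Distributions $\mu:A\to[0,1]$, mass $\le1$. Weak call-by-value reduction to distributions: $(\lambda x.M)V\to\{M[V/x]\}$; if $M\to\mu$ then $MV\to\mu V$; if $N\to\nu$ then $MN\to M\nu$; pairs left then right; $\mathtt{rec}\langle U,V,\mathtt 0\rangle\to\{U\}$; $\mathtt{rec}\langle U,V,\mathtt S\mathbf n\rangle\to\{V\,\mathbf n\,(\mathtt{rec}\langle U,V,\mathbf n\rangle)\}$; $\pi_i$ project pairs of values; $\mathtt R\to\{\mathbf n\mapsto2^{ -(n+1)}\}_n$; lifted to distributions (reduce reducible support elements, keep values). Evaluation $[\![M]\!](V)=\lim_k\mu_k(V)$, $\mu_0=\{M\}$, $\mu_{k+1}$ the reduct of $\mu_k$. $\mathbf{BIN}=\mathbb N\times\mathbb N$; $\mathrm{val}(P)$ is the dyadic rational $a/2^e$ denoted by the normal form $\langle\mathbf a,\mathbf e\rangle$ of a closed T-term $P:\mathbf{BIN}$. -}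

module Defs where

open import Data.Nat as ℕ using (ℕ; zero; suc; _≤_)
open import Data.Integer using (+_)
open import Data.Rational using (ℚ; 0ℚ; 1ℚ; _+_; _*_; _/_)
open import Data.List using (List; []; _∷_)
open import Data.List.Membership.Propositional using (_∈_)
open import Data.List.Relation.Unary.Any using (here; there)
open import Data.Maybe using (Maybe; just; nothing)
open import Data.Unit using () renaming (⊤ to ⊤′)
open import Data.Empty using () renaming (⊥ to ⊥′)
open import Data.Bool using (Bool; true; false)
open import Data.Product using (_×_; _,_; ∃)
open import Relation.Binary.PropositionalEquality using (_≡_; refl)

infixr 7 _⇒_
infixr 8 _⊗_

data Ty : Set where
  Nat : Ty
  _⇒_ : Ty → Ty → Ty
  _⊗_ : Ty → Ty → Ty

Ctx : Set
Ctx = List Ty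

-- the triple σ × (ℕ → σ → σ) × ℕ is read as right-nested pairs
data Term (Γ : Ctx) : Ty → Set where
  var  : ∀ {τ} → τ ∈ Γ → Term Γ τ
  lam  : ∀ {σ τ} → Term (σ ∷ Γ) τ → Term Γ (σ ⇒ τ)
  app  : ∀ {σ τ} → Term Γ (σ ⇒ τ) → Term Γ σ → Term Γ τ
  pair : ∀ {σ τ} → Term Γ σ → Term Γ τ → Term Γ (σ ⊗ τ)
  pi1  : ∀ {σ τ} → Term Γ (σ ⊗ τ ⇒ σ)
  pi2  : ∀ {σ τ} → Term Γ (σ ⊗ τ ⇒ τ)
  rec  : ∀ {σ} → Term Γ (σ ⊗ (Nat ⇒ σ ⇒ σ) ⊗ Nat ⇒ σ)
  zer  : Term Γ Nat
  suc′ : Term Γ (Nat ⇒ Nat)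
  R    : Term Γ Nat

Closed : Ty → Set
Closed = Term []

BIN : Ty
BIN = Nat ⊗ Nat

-- Gödel's System T: terms not containing R
RFree : ∀ {Γ τ} → Term Γ τ → Set
RFree (var x)    = ⊤′
RFree (lam M)    = RFree M
RFree (app M N)  = RFree M × RFree N
RFree (pair M N) = RFree M × RFree N
RFree pi1        = ⊤′
RFree pi2        = ⊤′
RFree rec        = ⊤′
RFree zer        = ⊤′
RFree suc′       = ⊤′
RFree R          = ⊥′

num : ∀ {Γ} → ℕ → Term Γ Nat
num zero    = zer
num (suc n) = app suc′ (num n)

Ren : Ctx → Ctx → Set
Ren Γ Δ = ∀ {τ} → τ ∈ Γ → τ ∈ Δ

ext : ∀ {Γ Δ σ} → Ren Γ Δ → Ren (σ ∷ Γ) (σ ∷ Δ)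
ext ρ (here p)  = here p
ext ρ (there x) = there (ρ x)

rename : ∀ {Γ Δ τ} → Ren Γ Δ → Term Γ τ → Term Δ τ
rename ρ (var x)    = var (ρ x)
rename ρ (lam M)    = lam (rename (ext ρ) M)
rename ρ (app M N)  = app (rename ρ M) (rename ρ N)
rename ρ (pair M N) = pair (rename ρ M) (rename ρ N)
rename ρ pi1        = pi1
rename ρ pi2        = pi2
rename ρ rec        = rec
rename ρ zer        = zer
rename ρ suc′       = suc′
rename ρ R          = R

Sub : Ctx → Ctx → Set
Sub Γ Δ = ∀ {τ} → τ ∈ Γ → Term Δ τ

exts : ∀ {Γ Δ σ} → Sub Γ Δ → Sub (σ ∷ Γ) (σ ∷ Δ)
exts s (here refl) = var (here refl)
exts s (there x)   = rename there (s x)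

subst : ∀ {Γ Δ τ} → Sub Γ Δ → Term Γ τ → Term Δ τ
subst s (var x)    = s x
subst s (lam M)    = lam (subst (exts s) M)
subst s (app M N)  = app (subst s M) (subst s N)
subst s (pair M N) = pair (subst s M) (subst s N)
subst s pi1        = pi1
subst s pi2        = pi2
subst s rec        = rec
subst s zer        = zer
subst s suc′       = suc′
subst s R          = R

_[_] : ∀ {σ τ} → Term (σ ∷ []) τ → Closed σ → Closed τ
_[_] {σ} M V = subst s M
  where
  s : Sub (σ ∷ []) []
  s (here refl) = V
  s (there ())

-- One step of weak call-by-value reduction of a closed term.
-- `stop`  : the term does not reduce (it is a value, or stuck)
-- `det M` : reduces to the Dirac distribution {M}
-- `rnd f` : reduces to the distribution  f n ↦ 2^-(n+1)

data Result (τ : Ty) : Set where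
  stop : Result τ
  det  : Closed τ → Result τ
  rnd  : (ℕ → Closed τ) → Result τ

contract : ∀ {σ τ} → Closed (σ ⇒ τ) → Closed σ → Result τ
contract (lam M) V = det (M [ V ])
contract pi1 (pair V W) = det V
contract pi2 (pair V W) = det W
contract rec (pair U (pair V zer)) = det U
contract rec (pair U (pair V (app suc′ n))) =
  det (app (app V n) (app rec (pair U (pair V n))))
contract _ _ = stop

step : ∀ {τ} → Closed τ → Result τ
step (var ())
step (lam M) = stop
step (pair M N) with step M
... | det M′ = det (pair M′ N)
... | rnd f  = rnd (λ n → pair (f n) N)
... | stop with step N
...   | det N′ = det (pair M N′)
...   | rnd f  = rnd (λ n → pair M (f n))
...   | stop   = stop
step (app M N) with step N
... | det N′ = det (app M N′)
... | rnd f  = rnd (λ n → app M (f n))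
... | stop with step M
...   | det M′ = det (app M′ N)
...   | rnd f  = rnd (λ n → app (f n) N)
...   | stop   = contract M N
step pi1  = stop
step pi2  = stop
step rec  = stop
step zer  = stop
step suc′ = stop
step R    = rnd num

half^ : ℕ → ℚ
half^ zero    = 1ℚ
half^ (suc e) = (+ 1 / 2) * half^ e

isNum : Closed Nat → ℕ → Bool
isNum zer zero = true
isNum (app suc′ M) (suc k) = isNum M k
isNum _ _ = false

ind : Bool → ℚ
ind true  = 1ℚ
ind false = 0ℚ

sumTo : ℕ → (ℕ → ℚ) → ℚ
sumTo zero    f = 0ℚ
sumTo (suc N) f = sumTo N f + f N

-- trunc j N M k : the mass that μ_j (j-th iterate of the lifted reduction
-- starting from {M}) gives to the numeral k, where each R-step only
-- keeps its first N outcomes.  It is nondecreasing in j and in N, and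
-- sup_N (trunc j N M k) = μ_j(k).
trunc : ℕ → ℕ → Closed Nat → ℕ → ℚ
trunc zero N M k = ind (isNum M k)
trunc (suc j) N M k with step M
... | stop   = ind (isNum M k)
... | det M′ = trunc j N M′ k
... | rnd f  = sumTo N (λ n → half^ (suc n) * trunc j N (f n) k)

-- approximation of [[M]](k): [[M]](k) = lim_j approx j M k = sup_j approx j M k
approx : ℕ → Closed Nat → ℕ → ℚ
approx j M k = trunc j j M k

run : ∀ {τ} → ℕ → Closed τ → Maybe (Closed τ)
run zero M with step M
... | stop = just M
... | _    = nothing
run (suc j) M with step M
... | stop   = just M
... | det M′ = run j M′
... | rnd _  = nothing

_⇓_ : ∀ {τ} → Closed τ → Closed τ → Set
M ⇓ V = ∃ λ j → run j M ≡ just V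

dyadic : ℕ → ℕ → ℚ
dyadic a e = (+ a / 1) * half^ e

-- A closed term of T^R denotes a countably branching tree: its leaves are the possible
-- results and its nodes are the draws of R, the i-th child carrying probability 2^-(i+1);
-- adequacy says that the reduction of the term follows this tree.  Continuation passing
-- turns the tree into a System T computation as soon as one fixes how a node combines
-- the results of its children, provided a node only looks at finitely many of them.
-- Pruning the tree so that a node reached after d draws keeps its first n + d + 1
-- children, two such combiners (weighted sum, maximum) give T programs computing the
-- dyadic weight ν_n(k) that the pruned tree gives to k, and a bound beyond which ν_n
-- vanishes.  Pruning at depth d loses mass at most 2^-(n+d+1), so ν_n has total mass at
-- least 1 - 2^-n.  As ν_n lies below the approximants of the operational semantics from
-- some index on, and those have mass at most 1, the ℓ¹ distance is at most 2^-n ≤ 1/n.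
module Submission where

open import Defs
open import Data.Nat using (ℕ; NonZero) renaming (_≤_ to _≤ℕ_)
open import Data.Integer using (+_)
open import Data.Rational using (ℚ; 0ℚ; _+_; _-_; _/_; ∣_∣; _≤_; _<_)
open import Data.Product using (Σ; ∃; _×_; proj₁; proj₂)
open import Relation.Binary.PropositionalEquality using (_≡_)

open import Data.Bool using (Bool; true; false)
open import Data.Empty using (⊥-elim)
open import Data.Integer using () renaming (_+_ to _+ℤ_)
import Data.Integer.Properties as ℤP
open import Data.List using ([]; _∷_)
open import Data.List.Membership.Propositional using (_∈_)
open import Data.List.Relation.Unary.Any using (here; there)
open import Data.Maybe using (just)
open import Data.Nat as ℕ using (zero; suc; _⊔_; _∸_; _^_)
  renaming (_+_ to _+ℕ_; _*_ to _*ℕ_; _<_ to _<ℕ_)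
open import Data.Nat.Coprimality using (1-coprimeTo) renaming (sym to coprime-sym)
import Data.Nat.Properties as ℕP
open import Data.Product using (_,_)
open import Data.Rational using (1ℚ; mkℚ; -_; nonNegative) renaming (_*_ to _*ℚ_)
import Data.Rational.Properties as ℚP
open import Data.Rational.Solver using (module +-*-Solver)
open import Data.Sum using (inj₁; inj₂)
open import Data.Unit using (⊤; tt)
open import Relation.Binary.PropositionalEquality
  using (_≢_; refl; sym; trans; cong; cong₂; module ≡-Reasoning)
  renaming (subst to transport)

private
  variable
    Γ Δ Θ : Ctx
    σ τ : Ty

_≗ʳ_ : Ren Γ Δ → Ren Γ Δ → Set
_≗ʳ_ {Γ} ρ ρ′ = ∀ {τ} (x : τ ∈ Γ) → ρ x ≡ ρ′ x

_≗ˢ_ : Sub Γ Δ → Sub Γ Δ → Set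
_≗ˢ_ {Γ} s s′ = ∀ {τ} (x : τ ∈ Γ) → s x ≡ s′ x

ext-cong : {ρ ρ′ : Ren Γ Δ} → ρ ≗ʳ ρ′ → ext {σ = σ} ρ ≗ʳ ext ρ′
ext-cong e (here p)  = refl
ext-cong e (there x) = cong there (e x)

rename-cong : {ρ ρ′ : Ren Γ Δ} → ρ ≗ʳ ρ′ → (M : Term Γ τ) → rename ρ M ≡ rename ρ′ M
rename-cong e (var x)    = cong var (e x)
rename-cong e (lam M)    = cong lam (rename-cong (ext-cong e) M)
rename-cong e (app M N)  = cong₂ app (rename-cong e M) (rename-cong e N)
rename-cong e (pair M N) = cong₂ pair (rename-cong e M) (rename-cong e N)
rename-cong e pi1        = refl
rename-cong e pi2        = refl
rename-cong e rec        = refl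
rename-cong e zer        = refl
rename-cong e suc′       = refl
rename-cong e R          = refl

rename-∘ : (ρ₁ : Ren Γ Δ) (ρ₂ : Ren Δ Θ) (M : Term Γ τ) →
           rename ρ₂ (rename ρ₁ M) ≡ rename (λ x → ρ₂ (ρ₁ x)) M
rename-∘ ρ₁ ρ₂ (var x)    = refl
rename-∘ ρ₁ ρ₂ (lam M)    =
  cong lam (trans (rename-∘ (ext ρ₁) (ext ρ₂) M) (rename-cong ext-∘ M))
  where
  ext-∘ : (λ x → ext ρ₂ (ext ρ₁ x)) ≗ʳ ext (λ x → ρ₂ (ρ₁ x))
  ext-∘ (here p)  = refl
  ext-∘ (there x) = refl
rename-∘ ρ₁ ρ₂ (app M N)  = cong₂ app (rename-∘ ρ₁ ρ₂ M) (rename-∘ ρ₁ ρ₂ N)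
rename-∘ ρ₁ ρ₂ (pair M N) = cong₂ pair (rename-∘ ρ₁ ρ₂ M) (rename-∘ ρ₁ ρ₂ N)
rename-∘ ρ₁ ρ₂ pi1        = refl
rename-∘ ρ₁ ρ₂ pi2        = refl
rename-∘ ρ₁ ρ₂ rec        = refl
rename-∘ ρ₁ ρ₂ zer        = refl
rename-∘ ρ₁ ρ₂ suc′       = refl
rename-∘ ρ₁ ρ₂ R          = refl

exts-cong : {s s′ : Sub Γ Δ} → s ≗ˢ s′ → exts {σ = σ} s ≗ˢ exts s′
exts-cong e (here refl) = refl
exts-cong e (there x)   = cong (rename there) (e x)

subst-cong : {s s′ : Sub Γ Δ} → s ≗ˢ s′ → (M : Term Γ τ) → subst s M ≡ subst s′ M
subst-cong e (var x)    = e x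
subst-cong e (lam M)    = cong lam (subst-cong (exts-cong e) M)
subst-cong e (app M N)  = cong₂ app (subst-cong e M) (subst-cong e N)
subst-cong e (pair M N) = cong₂ pair (subst-cong e M) (subst-cong e N)
subst-cong e pi1        = refl
subst-cong e pi2        = refl
subst-cong e rec        = refl
subst-cong e zer        = refl
subst-cong e suc′       = refl
subst-cong e R          = refl

subst-rename : (ρ : Ren Γ Δ) (s : Sub Δ Θ) (M : Term Γ τ) →
               subst s (rename ρ M) ≡ subst (λ x → s (ρ x)) M
subst-rename ρ s (var x)    = refl
subst-rename ρ s (lam M)    =
  cong lam (trans (subst-rename (ext ρ) (exts s) M) (subst-cong exts-ext M))
  where
  exts-ext : (λ x → exts s (ext ρ x)) ≗ˢ exts (λ x → s (ρ x))
  exts-ext (here refl) = refl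
  exts-ext (there x)   = refl
subst-rename ρ s (app M N)  = cong₂ app (subst-rename ρ s M) (subst-rename ρ s N)
subst-rename ρ s (pair M N) = cong₂ pair (subst-rename ρ s M) (subst-rename ρ s N)
subst-rename ρ s pi1        = refl
subst-rename ρ s pi2        = refl
subst-rename ρ s rec        = refl
subst-rename ρ s zer        = refl
subst-rename ρ s suc′       = refl
subst-rename ρ s R          = refl

rename-subst : (s : Sub Γ Δ) (ρ : Ren Δ Θ) (M : Term Γ τ) →
               rename ρ (subst s M) ≡ subst (λ x → rename ρ (s x)) M
rename-subst s ρ (var x)    = refl
rename-subst s ρ (lam M)    =
  cong lam (trans (rename-subst (exts s) (ext ρ) M) (subst-cong ext-exts M))
  where
  ext-exts : (λ x → rename (ext ρ) (exts s x)) ≗ˢ exts (λ x → rename ρ (s x))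
  ext-exts (here refl) = refl
  ext-exts (there x)   = trans (rename-∘ there (ext ρ) (s x)) (sym (rename-∘ ρ there (s x)))
rename-subst s ρ (app M N)  = cong₂ app (rename-subst s ρ M) (rename-subst s ρ N)
rename-subst s ρ (pair M N) = cong₂ pair (rename-subst s ρ M) (rename-subst s ρ N)
rename-subst s ρ pi1        = refl
rename-subst s ρ pi2        = refl
rename-subst s ρ rec        = refl
rename-subst s ρ zer        = refl
rename-subst s ρ suc′       = refl
rename-subst s ρ R          = refl

subst-∘ : (s₁ : Sub Γ Δ) (s₂ : Sub Δ Θ) (M : Term Γ τ) →
          subst s₂ (subst s₁ M) ≡ subst (λ x → subst s₂ (s₁ x)) M
subst-∘ s₁ s₂ (var x)    = refl
subst-∘ s₁ s₂ (lam M)    =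
  cong lam (trans (subst-∘ (exts s₁) (exts s₂) M) (subst-cong exts-∘ M))
  where
  exts-∘ : (λ x → subst (exts s₂) (exts s₁ x)) ≗ˢ exts (λ x → subst s₂ (s₁ x))
  exts-∘ (here refl) = refl
  exts-∘ (there x)   = trans (subst-rename there (exts s₂) (s₁ x)) (sym (rename-subst s₂ there (s₁ x)))
subst-∘ s₁ s₂ (app M N)  = cong₂ app (subst-∘ s₁ s₂ M) (subst-∘ s₁ s₂ N)
subst-∘ s₁ s₂ (pair M N) = cong₂ pair (subst-∘ s₁ s₂ M) (subst-∘ s₁ s₂ N)
subst-∘ s₁ s₂ pi1        = refl
subst-∘ s₁ s₂ pi2        = refl
subst-∘ s₁ s₂ rec        = refl
subst-∘ s₁ s₂ zer        = refl
subst-∘ s₁ s₂ suc′       = refl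
subst-∘ s₁ s₂ R          = refl

subst-id : (s : Sub Γ Γ) → s ≗ˢ var → (M : Term Γ τ) → subst s M ≡ M
subst-id s e (var x)    = e x
subst-id s e (lam M)    = cong lam (subst-id (exts s) exts-var M)
  where
  exts-var : exts s ≗ˢ var
  exts-var (here refl) = refl
  exts-var (there x)   = cong (rename there) (e x)
subst-id s e (app M N)  = cong₂ app (subst-id s e M) (subst-id s e N)
subst-id s e (pair M N) = cong₂ pair (subst-id s e M) (subst-id s e N)
subst-id s e pi1        = refl
subst-id s e pi2        = refl
subst-id s e rec        = refl
subst-id s e zer        = refl
subst-id s e suc′       = refl
subst-id s e R          = refl

subst-closed : (s : Sub [] []) (M : Closed τ) → subst s M ≡ M
subst-closed s = subst-id s (λ ())

_∷ˢ_ : Closed σ → Sub Γ [] → Sub (σ ∷ Γ) []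
(V ∷ˢ s) (here refl) = V
(V ∷ˢ s) (there x)   = s x

subst-exts-[] : (s : Sub Γ []) (V : Closed σ) (M : Term (σ ∷ Γ) τ) →
                subst (exts s) M [ V ] ≡ subst (V ∷ˢ s) M
subst-exts-[] s V M = trans (subst-∘ (exts s) _ M) (subst-cong exts-[] M)
  where
  exts-[] : (λ x → subst _ (exts s x)) ≗ˢ (V ∷ˢ s)
  exts-[] (here refl) = refl
  exts-[] (there x)   = trans (subst-rename there _ (s x)) (subst-closed _ (s x))

-- Denotational semantics in the monad of countably branching trees

data Tree (A : Set) : Set where
  leaf : A → Tree A
  node : (ℕ → Tree A) → Tree A

_>>=_ : {A B : Set} → Tree A → (A → Tree B) → Tree B
leaf a >>= k = k a
node f >>= k = node (λ i → f i >>= k)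

Val : Ty → Set
Val Nat     = ℕ
Val (σ ⇒ τ) = Val σ → Tree (Val τ)
Val (σ ⊗ τ) = Val σ × Val τ

Env : Ctx → Set
Env Γ = ∀ {τ} → τ ∈ Γ → Val τ

_∷ᵉ_ : Val σ → Env Γ → Env (σ ∷ Γ)
(v ∷ᵉ ρ) (here refl) = v
(v ∷ᵉ ρ) (there x)   = ρ x

∅ᵉ : Env []
∅ᵉ ()

recTree : Val σ → Val (Nat ⇒ σ ⇒ σ) → ℕ → Tree (Val σ)
recTree u v zero    = leaf u
recTree u v (suc n) = recTree u v n >>= λ r → v n >>= λ g → g r

⟦_⟧ : Term Γ τ → Env Γ → Tree (Val τ)
⟦ var x ⟧    ρ = leaf (ρ x)
⟦ lam M ⟧    ρ = leaf (λ v → ⟦ M ⟧ (v ∷ᵉ ρ))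
⟦ app M N ⟧  ρ = ⟦ N ⟧ ρ >>= λ v → ⟦ M ⟧ ρ >>= λ f → f v
⟦ pair M N ⟧ ρ = ⟦ M ⟧ ρ >>= λ a → ⟦ N ⟧ ρ >>= λ b → leaf (a , b)
⟦ pi1 ⟧      ρ = leaf (λ p → leaf (proj₁ p))
⟦ pi2 ⟧      ρ = leaf (λ p → leaf (proj₂ p))
⟦ rec ⟧      ρ = leaf (λ p → recTree (proj₁ p) (proj₁ (proj₂ p)) (proj₂ (proj₂ p)))
⟦ zer ⟧      ρ = leaf zero
⟦ suc′ ⟧     ρ = leaf (λ n → leaf (suc n))
⟦ R ⟧        ρ = node leaf

⟦num⟧ : ∀ m (ρ : Env Γ) → ⟦ num m ⟧ ρ ≡ leaf m
⟦num⟧ zero    ρ = refl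
⟦num⟧ (suc m) ρ rewrite ⟦num⟧ m ρ = refl

-- Adequacy

data Steps {τ} : ℕ → Closed τ → Closed τ → Set where
  done : ∀ {M} → Steps 0 M M
  more : ∀ {d M M′ M″} → step M ≡ det M′ → Steps d M′ M″ → Steps (suc d) M M″

Steps-trans : ∀ {d e} {M M′ M″ : Closed τ} → Steps d M M′ → Steps e M′ M″ → Steps (d +ℕ e) M M″
Steps-trans done       s = s
Steps-trans (more x r) s = more x (Steps-trans r s)

mutual
  _≈ᵛ_ : Closed τ → Val τ → Set
  _≈ᵛ_ {Nat}   V n = V ≡ num n
  _≈ᵛ_ {σ ⇒ τ} V f = step V ≡ stop × (∀ W w → W ≈ᵛ w → app V W ≈ᵗ f w)
  _≈ᵛ_ {σ ⊗ τ} V p = Σ (Closed σ) λ V₁ → Σ (Closed τ) λ V₂ →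
                       V ≡ pair V₁ V₂ × V₁ ≈ᵛ proj₁ p × V₂ ≈ᵛ proj₂ p

  _≈ᵗ_ : Closed τ → Tree (Val τ) → Set
  M ≈ᵗ leaf v = Σ ℕ λ d → Σ _ λ V → Steps d M V × step V ≡ stop × V ≈ᵛ v
  _≈ᵗ_ {τ} M (node f) = Σ ℕ λ d → Σ _ λ M′ → Steps d M M′ ×
                          Σ (ℕ → Closed τ) λ g → step M′ ≡ rnd g × (∀ i → g i ≈ᵗ f i)

step-num : ∀ n → step {Nat} (num n) ≡ stop
step-num zero    = refl
step-num (suc n) rewrite step-num n = refl

step-pair : {M : Closed σ} {N : Closed τ} → step M ≡ stop → step N ≡ stop → step (pair M N) ≡ stop
step-pair e₁ e₂ rewrite e₁ | e₂ = refl

step-app : (M : Closed (σ ⇒ τ)) (N : Closed σ) → step N ≡ stop → step M ≡ stop →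
           step (app M N) ≡ contract M N
step-app M N e₁ e₂ rewrite e₁ | e₂ = refl

≈ᵛ-stop : {V : Closed τ} {v : Val τ} → V ≈ᵛ v → step V ≡ stop
≈ᵛ-stop {Nat}   {v = n} refl = step-num n
≈ᵛ-stop {σ ⇒ τ} h = proj₁ h
≈ᵛ-stop {σ ⊗ τ} (V₁ , V₂ , refl , h₁ , h₂) =
  step-pair {M = V₁} {N = V₂} (≈ᵛ-stop h₁) (≈ᵛ-stop h₂)

≈ᵗ-steps : ∀ {d} {M M′ : Closed τ} (t : Tree (Val τ)) → Steps d M M′ → M′ ≈ᵗ t → M ≈ᵗ t
≈ᵗ-steps (leaf v) s (_ , V , s′ , h) = _ , V , Steps-trans s s′ , h
≈ᵗ-steps (node f) s (_ , V , s′ , h) = _ , V , Steps-trans s s′ , h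

≈ᵗ-det : {M M′ : Closed τ} (t : Tree (Val τ)) → step M ≡ det M′ → M′ ≈ᵗ t → M ≈ᵗ t
≈ᵗ-det t eq = ≈ᵗ-steps t (more eq done)

≈ᵗ-leaf : {V : Closed τ} {v : Val τ} → V ≈ᵛ v → V ≈ᵗ leaf v
≈ᵗ-leaf h = 0 , _ , done , ≈ᵛ-stop h , h

record EvalCtx (σ τ : Ty) : Set where
  field
    plug     : Closed σ → Closed τ
    plug-det : ∀ {M M′} → step M ≡ det M′ → step (plug M) ≡ det (plug M′)
    plug-rnd : ∀ {M g} → step M ≡ rnd g → step (plug M) ≡ rnd (λ i → plug (g i))
open EvalCtx

Steps-plug : (E : EvalCtx σ τ) → ∀ {d M M′} → Steps d M M′ → Steps d (plug E M) (plug E M′)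
Steps-plug E done       = done
Steps-plug E (more x s) = more (plug-det E x) (Steps-plug E s)

≈ᵗ->>= : (E : EvalCtx σ τ) {M : Closed σ} (t : Tree (Val σ)) {k : Val σ → Tree (Val τ)} →
         M ≈ᵗ t → (∀ V v → V ≈ᵛ v → plug E V ≈ᵗ k v) → plug E M ≈ᵗ (t >>= k)
≈ᵗ->>= E (leaf v) {k} (_ , V , s , _ , h) K = ≈ᵗ-steps (k v) (Steps-plug E s) (K V v h)
≈ᵗ->>= E (node f) (d , M′ , s , g , eq , h) K =
  d , plug E M′ , Steps-plug E s , (λ i → plug E (g i)) , plug-rnd E eq ,
  λ i → ≈ᵗ->>= E (f i) (h i) K

appʳ : Closed (σ ⇒ τ) → EvalCtx σ τ
appʳ M = record
  { plug = app M ; plug-det = λ {X} → det-case {X} ; plug-rnd = λ {X} → rnd-case {X} }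
  where
  det-case : ∀ {X X′} → step X ≡ det X′ → step (app M X) ≡ det (app M X′)
  det-case eq rewrite eq = refl
  rnd-case : ∀ {X g} → step X ≡ rnd g → step (app M X) ≡ rnd (λ i → app M (g i))
  rnd-case eq rewrite eq = refl

appˡ : (V : Closed σ) → step V ≡ stop → EvalCtx (σ ⇒ τ) τ
appˡ {σ} {τ} V stopV = record
  { plug = λ X → app X V ; plug-det = λ {X} → det-case {X} ; plug-rnd = λ {X} → rnd-case {X} }
  where
  det-case : {X X′ : Closed (σ ⇒ τ)} → step X ≡ det X′ → step (app X V) ≡ det (app X′ V)
  det-case eq rewrite stopV | eq = refl
  rnd-case : {X : Closed (σ ⇒ τ)} {g : ℕ → Closed (σ ⇒ τ)} →
             step X ≡ rnd g → step (app X V) ≡ rnd (λ i → app (g i) V)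
  rnd-case eq rewrite stopV | eq = refl

pairˡ : Closed τ → EvalCtx σ (σ ⊗ τ)
pairˡ N = record
  { plug = λ X → pair X N ; plug-det = λ {X} → det-case {X} ; plug-rnd = λ {X} → rnd-case {X} }
  where
  det-case : ∀ {X X′} → step X ≡ det X′ → step (pair X N) ≡ det (pair X′ N)
  det-case eq rewrite eq = refl
  rnd-case : ∀ {X g} → step X ≡ rnd g → step (pair X N) ≡ rnd (λ i → pair (g i) N)
  rnd-case eq rewrite eq = refl

pairʳ : (V : Closed σ) → step V ≡ stop → EvalCtx τ (σ ⊗ τ)
pairʳ {σ} {τ} V stopV = record
  { plug = pair V ; plug-det = λ {X} → det-case {X} ; plug-rnd = λ {X} → rnd-case {X} }
  where
  det-case : {X X′ : Closed τ} → step X ≡ det X′ → step (pair V X) ≡ det (pair V X′)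
  det-case eq rewrite stopV | eq = refl
  rnd-case : {X : Closed τ} {g : ℕ → Closed τ} →
             step X ≡ rnd g → step (pair V X) ≡ rnd (λ i → pair V (g i))
  rnd-case eq rewrite stopV | eq = refl

_≈ˢ_ : Sub Γ [] → Env Γ → Set
_≈ˢ_ {Γ} s ρ = ∀ {τ} (x : τ ∈ Γ) → s x ≈ᵛ ρ x

≈ˢ-∷ : {s : Sub Γ []} {ρ : Env Γ} {V : Closed σ} {v : Val σ} →
       V ≈ᵛ v → s ≈ˢ ρ → (V ∷ˢ s) ≈ˢ (v ∷ᵉ ρ)
≈ˢ-∷ h g (here refl) = h
≈ˢ-∷ h g (there x)   = g x

≈ᵗ-pi1 : {W : Closed (σ ⊗ τ)} {p : Val (σ ⊗ τ)} → W ≈ᵛ p → app pi1 W ≈ᵗ leaf (proj₁ p)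
≈ᵗ-pi1 hp@(V₁ , V₂ , refl , h₁ , _) =
  ≈ᵗ-det (leaf _) (step-app pi1 (pair V₁ V₂) (≈ᵛ-stop hp) refl) (≈ᵗ-leaf h₁)

≈ᵗ-pi2 : {W : Closed (σ ⊗ τ)} {p : Val (σ ⊗ τ)} → W ≈ᵛ p → app pi2 W ≈ᵗ leaf (proj₂ p)
≈ᵗ-pi2 hp@(V₁ , V₂ , refl , _ , h₂) =
  ≈ᵗ-det (leaf _) (step-app pi2 (pair V₁ V₂) (≈ᵛ-stop hp) refl) (≈ᵗ-leaf h₂)

≈ᵛ-triple : {U : Closed σ} {V : Closed (Nat ⇒ σ ⇒ σ)} {u : Val σ} {v : Val (Nat ⇒ σ ⇒ σ)} →
            U ≈ᵛ u → V ≈ᵛ v → ∀ n → pair U (pair V (num n)) ≈ᵛ (u , v , n)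
≈ᵛ-triple {U = U} {V} hu hv n = U , pair V (num n) , refl , hu , (V , num n , refl , hv , refl)

≈ᵗ-recTree : {U : Closed σ} {V : Closed (Nat ⇒ σ ⇒ σ)} {u : Val σ} {v : Val (Nat ⇒ σ ⇒ σ)} →
             U ≈ᵛ u → V ≈ᵛ v → ∀ n → app rec (pair U (pair V (num n))) ≈ᵗ recTree u v n
≈ᵗ-recTree {U = U} {V} {u} hu hv zero =
  ≈ᵗ-det (leaf u) (step-app rec (pair U (pair V zer)) (≈ᵛ-stop (≈ᵛ-triple hu hv zero)) refl)
    (≈ᵗ-leaf hu)
≈ᵗ-recTree {U = U} {V} {u} {v} hu hv (suc n) =
  ≈ᵗ-det (recTree u v (suc n))
    (step-app rec (pair U (pair V (num (suc n)))) (≈ᵛ-stop (≈ᵛ-triple hu hv (suc n))) refl)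
    (≈ᵗ->>= (appʳ (app V (num n))) (recTree u v n) (≈ᵗ-recTree hu hv n) λ X r hX →
      ≈ᵗ->>= (appˡ X (≈ᵛ-stop hX)) (v n) (proj₂ hv (num n) n refl) λ _ _ hG → proj₂ hG X r hX)

fundamental : (M : Term Γ τ) {s : Sub Γ []} {ρ : Env Γ} → s ≈ˢ ρ → subst s M ≈ᵗ ⟦ M ⟧ ρ
fundamental (var x) g = ≈ᵗ-leaf (g x)
fundamental (lam M) {s} {ρ} g = ≈ᵗ-leaf (refl , body)
  where
  body : ∀ W w → W ≈ᵛ w → app (lam (subst (exts s) M)) W ≈ᵗ ⟦ M ⟧ (w ∷ᵉ ρ)
  body W w hW =
    ≈ᵗ-det (⟦ M ⟧ (w ∷ᵉ ρ)) (step-app (lam (subst (exts s) M)) W (≈ᵛ-stop hW) refl)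
      (transport (_≈ᵗ ⟦ M ⟧ (w ∷ᵉ ρ)) (sym (subst-exts-[] s W M)) (fundamental M (≈ˢ-∷ hW g)))
fundamental (app M N) {s} {ρ} g =
  ≈ᵗ->>= (appʳ (subst s M)) (⟦ N ⟧ ρ) (fundamental N g) λ V v hV →
    ≈ᵗ->>= (appˡ V (≈ᵛ-stop hV)) (⟦ M ⟧ ρ) (fundamental M g) λ W f hW → proj₂ hW V v hV
fundamental (pair M N) {s} {ρ} g =
  ≈ᵗ->>= (pairˡ (subst s N)) (⟦ M ⟧ ρ) (fundamental M g) λ V a hV →
    ≈ᵗ->>= (pairʳ V (≈ᵛ-stop hV)) (⟦ N ⟧ ρ) (fundamental N g) λ W b hW →
      ≈ᵗ-leaf (V , W , refl , hV , hW)
fundamental pi1 g = ≈ᵗ-leaf {v = λ p → leaf (proj₁ p)} (refl , λ _ _ → ≈ᵗ-pi1)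
fundamental pi2 g = ≈ᵗ-leaf {v = λ p → leaf (proj₂ p)} (refl , λ _ _ → ≈ᵗ-pi2)
fundamental rec g = ≈ᵗ-leaf {v = λ p → recTree (proj₁ p) (proj₁ (proj₂ p)) (proj₂ (proj₂ p))}
  (refl , λ { _ _ (_ , _ , refl , hu , (_ , _ , refl , hv , refl)) → ≈ᵗ-recTree hu hv _ })
fundamental zer  g = ≈ᵗ-leaf refl
fundamental suc′ g =
  ≈ᵗ-leaf {v = λ n → leaf (suc n)} (refl , λ { _ n refl → ≈ᵗ-leaf {V = num (suc n)} refl })
fundamental R    g = 0 , R , done , num , refl , λ i → ≈ᵗ-leaf refl

adequacy : (M : Closed τ) → M ≈ᵗ ⟦ M ⟧ ∅ᵉ
adequacy M = transport (_≈ᵗ ⟦ M ⟧ ∅ᵉ) (subst-closed var M) (fundamental M {s = var} (λ ()))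

Steps⇒run : ∀ {d} {M V : Closed τ} → Steps d M V → step V ≡ stop → run d M ≡ just V
Steps⇒run done st rewrite st = refl
Steps⇒run {d = suc d} (more eq s) st rewrite eq = Steps⇒run s st

data TTerm (Γ : Ctx) : Ty → Set where
  tvar  : τ ∈ Γ → TTerm Γ τ
  tlam  : TTerm (σ ∷ Γ) τ → TTerm Γ (σ ⇒ τ)
  tapp  : TTerm Γ (σ ⇒ τ) → TTerm Γ σ → TTerm Γ τ
  tpair : TTerm Γ σ → TTerm Γ τ → TTerm Γ (σ ⊗ τ)
  tpi1  : TTerm Γ (σ ⊗ τ ⇒ σ)
  tpi2  : TTerm Γ (σ ⊗ τ ⇒ τ)
  trec  : TTerm Γ (σ ⊗ (Nat ⇒ σ ⇒ σ) ⊗ Nat ⇒ σ)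
  tzer  : TTerm Γ Nat
  tsuc  : TTerm Γ (Nat ⇒ Nat)

embed : TTerm Γ τ → Term Γ τ
embed (tvar x)    = var x
embed (tlam M)    = lam (embed M)
embed (tapp M N)  = app (embed M) (embed N)
embed (tpair M N) = pair (embed M) (embed N)
embed tpi1        = pi1
embed tpi2        = pi2
embed trec        = rec
embed tzer        = zer
embed tsuc        = suc′

embed-RFree : (M : TTerm Γ τ) → RFree (embed M)
embed-RFree (tvar x)    = tt
embed-RFree (tlam M)    = embed-RFree M
embed-RFree (tapp M N)  = embed-RFree M , embed-RFree N
embed-RFree (tpair M N) = embed-RFree M , embed-RFree N
embed-RFree tpi1        = tt
embed-RFree tpi2        = tt
embed-RFree trec        = tt
embed-RFree tzer        = tt
embed-RFree tsuc        = tt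

tnum : ℕ → TTerm Γ Nat
tnum zero    = tzer
tnum (suc n) = tapp tsuc (tnum n)

embed-tnum : ∀ n → embed {Γ} (tnum n) ≡ num n
embed-tnum zero    = refl
embed-tnum (suc n) = cong (app suc′) (embed-tnum n)

Valᵀ : Ty → Set
Valᵀ Nat     = ℕ
Valᵀ (σ ⇒ τ) = Valᵀ σ → Valᵀ τ
Valᵀ (σ ⊗ τ) = Valᵀ σ × Valᵀ τ

Envᵀ : Ctx → Set
Envᵀ Γ = ∀ {τ} → τ ∈ Γ → Valᵀ τ

_∷ᵀ_ : Valᵀ σ → Envᵀ Γ → Envᵀ (σ ∷ Γ)
(v ∷ᵀ η) (here refl) = v
(v ∷ᵀ η) (there x)   = η x

∅ᵀ : Envᵀ []
∅ᵀ ()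

recᵀ : Valᵀ σ → Valᵀ (Nat ⇒ σ ⇒ σ) → ℕ → Valᵀ σ
recᵀ u v zero    = u
recᵀ u v (suc n) = v n (recᵀ u v n)

⟦_⟧ᵀ : TTerm Γ τ → Envᵀ Γ → Valᵀ τ
⟦ tvar x ⟧ᵀ    η = η x
⟦ tlam M ⟧ᵀ    η = λ v → ⟦ M ⟧ᵀ (v ∷ᵀ η)
⟦ tapp M N ⟧ᵀ  η = ⟦ M ⟧ᵀ η (⟦ N ⟧ᵀ η)
⟦ tpair M N ⟧ᵀ η = ⟦ M ⟧ᵀ η , ⟦ N ⟧ᵀ η
⟦ tpi1 ⟧ᵀ      η = proj₁
⟦ tpi2 ⟧ᵀ      η = proj₂
⟦ trec ⟧ᵀ      η = λ p → recᵀ (proj₁ p) (proj₁ (proj₂ p)) (proj₂ (proj₂ p))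
⟦ tzer ⟧ᵀ      η = zero
⟦ tsuc ⟧ᵀ      η = suc

⟦tnum⟧ᵀ : ∀ n (η : Envᵀ Γ) → ⟦ tnum n ⟧ᵀ η ≡ n
⟦tnum⟧ᵀ zero    η = refl
⟦tnum⟧ᵀ (suc n) η = cong suc (⟦tnum⟧ᵀ n η)

#0 : ∀ {Γ a} → TTerm (a ∷ Γ) a
#0 = tvar (here refl)
#1 : ∀ {Γ a b} → TTerm (b ∷ a ∷ Γ) a
#1 = tvar (there (here refl))
#2 : ∀ {Γ a b c} → TTerm (c ∷ b ∷ a ∷ Γ) a
#2 = tvar (there (there (here refl)))
#3 : ∀ {Γ a b c d} → TTerm (d ∷ c ∷ b ∷ a ∷ Γ) a
#3 = tvar (there (there (there (here refl))))
#4 : ∀ {Γ a b c d e} → TTerm (e ∷ d ∷ c ∷ b ∷ a ∷ Γ) a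
#4 = tvar (there (there (there (there (here refl)))))
#5 : ∀ {Γ a b c d e f} → TTerm (f ∷ e ∷ d ∷ c ∷ b ∷ a ∷ Γ) a
#5 = tvar (there (there (there (there (there (here refl))))))
#6 : ∀ {Γ a b c d e f g} → TTerm (g ∷ f ∷ e ∷ d ∷ c ∷ b ∷ a ∷ Γ) a
#6 = tvar (there (there (there (there (there (there (here refl)))))))

Agree : (τ : Ty) → Val τ → Valᵀ τ → Set
Agree Nat     n m = n ≡ m
Agree (σ ⇒ τ) f g = ∀ x y → Agree σ x y → Σ (Val τ) λ w → f x ≡ leaf w × Agree τ w (g y)
Agree (σ ⊗ τ) p q = Agree σ (proj₁ p) (proj₁ q) × Agree τ (proj₂ p) (proj₂ q)

Pure : Tree (Val τ) → Valᵀ τ → Set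
Pure {τ} t s = Σ (Val τ) λ w → t ≡ leaf w × Agree τ w s

recTree-pure : {u : Val σ} {u′ : Valᵀ σ} {v : Val (Nat ⇒ σ ⇒ σ)} {v′ : Valᵀ (Nat ⇒ σ ⇒ σ)} →
               Agree σ u u′ → Agree (Nat ⇒ σ ⇒ σ) v v′ → ∀ n → Pure (recTree u v n) (recᵀ u′ v′ n)
recTree-pure au av zero = _ , refl , au
recTree-pure au av (suc n) with recTree-pure au av n
... | r , er , ar rewrite er with av n n refl
...   | g , eg , ag rewrite eg = ag r _ ar

embed-pure : (M : TTerm Γ τ) (ρ : Env Γ) (η : Envᵀ Γ) →
             (∀ {τ} (x : τ ∈ Γ) → Agree τ (ρ x) (η x)) → Pure (⟦ embed M ⟧ ρ) (⟦ M ⟧ᵀ η)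
embed-pure (tvar x) ρ η h = _ , refl , h x
embed-pure (tlam M) ρ η h = _ , refl , λ x y a →
  embed-pure M (x ∷ᵉ ρ) (y ∷ᵀ η) λ { (here refl) → a ; (there z) → h z }
embed-pure (tapp M N) ρ η h with embed-pure N ρ η h
... | b , eb , ab rewrite eb with embed-pure M ρ η h
...   | f , ef , af rewrite ef = af b _ ab
embed-pure (tpair M N) ρ η h with embed-pure M ρ η h
... | a , ea , aa rewrite ea with embed-pure N ρ η h
...   | b , eb , ab rewrite eb = _ , refl , aa , ab
embed-pure tpi1 ρ η h = _ , refl , λ x y a → _ , refl , proj₁ a
embed-pure tpi2 ρ η h = _ , refl , λ x y a → _ , refl , proj₂ a
embed-pure trec ρ η h = _ , refl , λ { x y (au , av , refl) → recTree-pure au av (proj₂ (proj₂ x)) }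
embed-pure tzer ρ η h = _ , refl , refl
embed-pure tsuc ρ η h = _ , refl , λ x y a → _ , refl , cong suc a

-- Only first-order results are read off: nothing is claimed at function types.
Represents : (τ : Ty) → Valᵀ τ → Closed τ → Set
Represents Nat     n V = V ≡ num n
Represents (σ ⊗ τ) p V = Σ (Closed σ) λ V₁ → Σ (Closed τ) λ V₂ →
                           V ≡ pair V₁ V₂ × Represents σ (proj₁ p) V₁ × Represents τ (proj₂ p) V₂
Represents (σ ⇒ τ) f V = ⊤

≈ᵛ-represents : {V : Closed τ} {v : Val τ} {s : Valᵀ τ} → V ≈ᵛ v → Agree τ v s → Represents τ s V
≈ᵛ-represents {Nat}   h refl = h
≈ᵛ-represents {σ ⊗ τ} (V₁ , V₂ , e , h₁ , h₂) (a₁ , a₂) =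
  V₁ , V₂ , e , ≈ᵛ-represents h₁ a₁ , ≈ᵛ-represents h₂ a₂
≈ᵛ-represents {σ ⇒ τ} h a = tt

evaluate : (X : TTerm [] τ) → Σ (Closed τ) λ V → embed X ⇓ V × Represents τ (⟦ X ⟧ᵀ ∅ᵀ) V
evaluate X with embed-pure X ∅ᵉ ∅ᵀ (λ ()) | adequacy (embed X)
... | w , ew , aw | ad rewrite ew with ad
...   | d , V , s , st , h = V , (d , Steps⇒run s st) , ≈ᵛ-represents h aw

evaluate-ℕ²→ℕ : (Q : TTerm [] (Nat ⇒ Nat ⇒ Nat)) (m n : ℕ) →
                app (app (embed Q) (num m)) (num n) ⇓ num (⟦ Q ⟧ᵀ ∅ᵀ m n)
evaluate-ℕ²→ℕ Q m n with evaluate (tapp (tapp Q (tnum m)) (tnum n))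
... | _ , ⇓V , refl
  rewrite embed-tnum {[]} m | embed-tnum {[]} n | ⟦tnum⟧ᵀ m ∅ᵀ | ⟦tnum⟧ᵀ n ∅ᵀ = ⇓V

evaluate-ℕ³→BIN : (F : TTerm [] (Nat ⇒ Nat ⇒ Nat ⇒ BIN)) (m n k : ℕ) →
                  app (app (app (embed F) (num m)) (num n)) (num k)
                    ⇓ pair (num (proj₁ (⟦ F ⟧ᵀ ∅ᵀ m n k))) (num (proj₂ (⟦ F ⟧ᵀ ∅ᵀ m n k)))
evaluate-ℕ³→BIN F m n k with evaluate (tapp (tapp (tapp F (tnum m)) (tnum n)) (tnum k))
... | _ , ⇓V , (_ , _ , refl , refl , refl)
  rewrite embed-tnum {[]} m | embed-tnum {[]} n | embed-tnum {[]} k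
        | ⟦tnum⟧ᵀ m ∅ᵀ | ⟦tnum⟧ᵀ n ∅ᵀ | ⟦tnum⟧ᵀ k ∅ᵀ = ⇓V

-- Continuation-passing translation of T^R into System T

-- A node reached with counter c is interpreted by `combine c`, applied to the results of
-- its children; everything else is plain call-by-value continuation passing.
module CPS (A : Ty)
  (combine  : ∀ {Γ} → TTerm Γ (Nat ⇒ (Nat ⇒ A) ⇒ A))
  (combineᵀ : ℕ → (ℕ → Valᵀ A) → Valᵀ A)
  (⟦combine⟧ : ∀ {Γ} (η : Envᵀ Γ) c h → ⟦ combine ⟧ᵀ η c h ≡ combineᵀ c h)
  (combineᵀ-cong : ∀ c (h h′ : ℕ → Valᵀ A) → (∀ i → h i ≡ h′ i) → combineᵀ c h ≡ combineᵀ c h′)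
  where

  -- the ℕ arguments thread a counter, incremented at each draw
  C : Ty → Ty
  C X = Nat ⇒ (X ⇒ Nat ⇒ A) ⇒ A

  tyᶜ : Ty → Ty
  tyᶜ Nat     = Nat
  tyᶜ (σ ⇒ τ) = tyᶜ σ ⇒ C (tyᶜ τ)
  tyᶜ (σ ⊗ τ) = tyᶜ σ ⊗ tyᶜ τ

  ctxᶜ : Ctx → Ctx
  ctxᶜ []      = []
  ctxᶜ (σ ∷ Γ) = tyᶜ σ ∷ ctxᶜ Γ

  varᶜ : τ ∈ Γ → tyᶜ τ ∈ ctxᶜ Γ
  varᶜ (here refl) = here refl
  varᶜ (there x)   = there (varᶜ x)

  -- λ x c k. k x c
  unitᶜ : ∀ {Γ X} → TTerm Γ (X ⇒ C X)
  unitᶜ = tlam (tlam (tlam (tapp (tapp #0 #2) #1)))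

  -- λ m n c k. n c (λ x c′. m c′ (λ f c″. f x c″ k))
  appᶜ : ∀ {Γ X Y} → TTerm Γ (C (X ⇒ C Y) ⇒ C X ⇒ C Y)
  appᶜ = tlam (tlam (tlam (tlam (tapp (tapp #2 #1)
           (tlam (tlam (tapp (tapp #5 #0) (tlam (tlam (tapp (tapp (tapp #1 #3) #0) #4))))))))))

  -- λ m n c k. m c (λ a c′. n c′ (λ b c″. k ⟨a , b⟩ c″))
  pairᶜ : ∀ {Γ X Y} → TTerm Γ (C X ⇒ C Y ⇒ C (X ⊗ Y))
  pairᶜ = tlam (tlam (tlam (tlam (tapp (tapp #3 #1)
           (tlam (tlam (tapp (tapp #4 #0) (tlam (tlam (tapp (tapp #4 (tpair #3 #1)) #0))))))))))

  pi1ᶜ : ∀ {Γ X Y} → TTerm Γ (X ⊗ Y ⇒ C X)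
  pi1ᶜ = tlam (tlam (tlam (tapp (tapp #0 (tapp tpi1 #2)) #1)))

  pi2ᶜ : ∀ {Γ X Y} → TTerm Γ (X ⊗ Y ⇒ C Y)
  pi2ᶜ = tlam (tlam (tlam (tapp (tapp #0 (tapp tpi2 #2)) #1)))

  sucᶜ : ∀ {Γ} → TTerm Γ (Nat ⇒ C Nat)
  sucᶜ = tlam (tlam (tlam (tapp (tapp #0 (tapp tsuc #2)) #1)))

  -- λ c k. combine c (λ i. k i (suc c))
  Rᶜ : ∀ {Γ} → TTerm Γ (C Nat)
  Rᶜ = tlam (tlam (tapp (tapp combine #1) (tlam (tapp (tapp #1 #0) (tapp tsuc #2)))))

  -- λ p. rec ⟨unitᶜ u , λ i acc c k. acc c (λ r c′. v i c′ (λ g c″. g r c″ k)) , n⟩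
  -- where p = ⟨u , v , n⟩
  recᶜ : ∀ {Γ X} → TTerm Γ ((X ⊗ (Nat ⇒ C (X ⇒ C X)) ⊗ Nat) ⇒ C X)
  recᶜ = tlam (tapp trec (tpair (tapp unitᶜ (tapp tpi1 #0))
           (tpair (tlam (tlam (tlam (tlam (tapp (tapp #2 #1)
                     (tlam (tlam (tapp (tapp (tapp (tapp tpi1 (tapp tpi2 #6)) #5) #0)
                        (tlam (tlam (tapp (tapp (tapp #1 #3) #0) #4)))))))))))
                  (tapp tpi2 (tapp tpi2 #0)))))

  cps : Term Γ τ → TTerm (ctxᶜ Γ) (C (tyᶜ τ))
  cps (var x)    = tapp unitᶜ (tvar (varᶜ x))
  cps (lam M)    = tapp unitᶜ (tlam (cps M))
  cps (app M N)  = tapp (tapp appᶜ (cps M)) (cps N)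
  cps (pair M N) = tapp (tapp pairᶜ (cps M)) (cps N)
  cps pi1        = tapp unitᶜ pi1ᶜ
  cps pi2        = tapp unitᶜ pi2ᶜ
  cps rec        = tapp unitᶜ recᶜ
  cps zer        = tapp unitᶜ tzer
  cps suc′       = tapp unitᶜ sucᶜ
  cps R          = Rᶜ

  foldTree : {X : Set} → Tree X → ℕ → (X → ℕ → Valᵀ A) → Valᵀ A
  foldTree (leaf x) c κ = κ x c
  foldTree (node f) c κ = combineᵀ c (λ i → foldTree (f i) (suc c) κ)

  foldTree->>= : {X Y : Set} (t : Tree X) (f : X → Tree Y) (c : ℕ) (κ : Y → ℕ → Valᵀ A) →
                 foldTree (t >>= f) c κ ≡ foldTree t c (λ x c′ → foldTree (f x) c′ κ)
  foldTree->>= (leaf x) f c κ = refl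
  foldTree->>= (node g) f c κ = combineᵀ-cong c _ _ (λ i → foldTree->>= (g i) f (suc c) κ)

  mutual
    Related : (τ : Ty) → Val τ → Valᵀ (tyᶜ τ) → Set
    Related Nat     n m = n ≡ m
    Related (σ ⇒ τ) f g = ∀ x y → Related σ x y → RelatedC τ (f x) (g y)
    Related (σ ⊗ τ) p q = Related σ (proj₁ p) (proj₁ q) × Related τ (proj₂ p) (proj₂ q)

    RelatedC : (τ : Ty) → Tree (Val τ) → Valᵀ (C (tyᶜ τ)) → Set
    RelatedC τ t h = ∀ c κ κ′ → (∀ x y c′ → Related τ x y → κ x c′ ≡ κ′ y c′) →
                     foldTree t c κ ≡ h c κ′

  recTree-related :
    {u : Val σ} {u′ : Valᵀ (tyᶜ σ)} {v : Val (Nat ⇒ σ ⇒ σ)} {v′ : Valᵀ (tyᶜ (Nat ⇒ σ ⇒ σ))} →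
    Related σ u u′ → Related (Nat ⇒ σ ⇒ σ) v v′ → ∀ n →
    RelatedC σ (recTree u v n)
      (recᵀ (λ c k → k u′ c) (λ i acc c k → acc c (λ r c′ → v′ i c′ (λ g c″ → g r c″ k))) n)
  recTree-related ru rv zero c κ κ′ hκ = hκ _ _ c ru
  recTree-related {u = u} {v = v} ru rv (suc n) c κ κ′ hκ =
    trans (foldTree->>= (recTree u v n) _ c κ)
      (recTree-related ru rv n c _ _ λ r r′ c′ rr →
        trans (foldTree->>= (v n) _ c′ κ)
          (rv n n refl c′ _ _ λ g g′ c″ rg → rg r r′ rr c″ κ κ′ hκ))

  cps-related : (M : Term Γ τ) (ρ : Env Γ) (η : Envᵀ (ctxᶜ Γ)) →
                (∀ {τ} (x : τ ∈ Γ) → Related τ (ρ x) (η (varᶜ x))) →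
                RelatedC τ (⟦ M ⟧ ρ) (⟦ cps M ⟧ᵀ η)
  cps-related (var x) ρ η h c κ κ′ hκ = hκ _ _ c (h x)
  cps-related (lam M) ρ η h c κ κ′ hκ = hκ _ _ c λ x y rxy →
    cps-related M (x ∷ᵉ ρ) (y ∷ᵀ η) λ { (here refl) → rxy ; (there z) → h z }
  cps-related (app M N) ρ η h c κ κ′ hκ =
    trans (foldTree->>= (⟦ N ⟧ ρ) _ c κ)
      (cps-related N ρ η h c _ _ λ b b′ c′ rb →
        trans (foldTree->>= (⟦ M ⟧ ρ) _ c′ κ)
          (cps-related M ρ η h c′ _ _ λ f f′ c″ rf → rf b b′ rb c″ κ κ′ hκ))
  cps-related (pair M N) ρ η h c κ κ′ hκ =
    trans (foldTree->>= (⟦ M ⟧ ρ) _ c κ)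
      (cps-related M ρ η h c _ _ λ a a′ c′ ra →
        trans (foldTree->>= (⟦ N ⟧ ρ) _ c′ κ)
          (cps-related N ρ η h c′ _ _ λ b b′ c″ rb → hκ _ _ c″ (ra , rb)))
  cps-related pi1 ρ η h c κ κ′ hκ = hκ _ _ c λ p p′ rp c₁ κ₁ κ₁′ hκ₁ → hκ₁ _ _ c₁ (proj₁ rp)
  cps-related pi2 ρ η h c κ κ′ hκ = hκ _ _ c λ p p′ rp c₁ κ₁ κ₁′ hκ₁ → hκ₁ _ _ c₁ (proj₂ rp)
  cps-related rec ρ η h c κ κ′ hκ = hκ _ _ c λ { p p′ (ru , rv , refl) →
    recTree-related ru rv (proj₂ (proj₂ p)) }
  cps-related zer ρ η h c κ κ′ hκ = hκ _ _ c refl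
  cps-related suc′ ρ η h c κ κ′ hκ = hκ _ _ c λ n n′ rn c₁ κ₁ κ₁′ hκ₁ → hκ₁ _ _ c₁ (cong suc rn)
  cps-related R ρ η h c κ κ′ hκ =
    trans (combineᵀ-cong c _ _ (λ i → hκ i i (suc c) refl)) (sym (⟦combine⟧ _ c _))

  cps-correct : (M : Closed (Nat ⇒ Nat)) (m c : ℕ) (κ : ℕ → ℕ → Valᵀ A) →
                foldTree (⟦ app M (num m) ⟧ ∅ᵉ) c κ ≡ ⟦ cps M ⟧ᵀ ∅ᵀ c (λ f c′ → f m c′ κ)
  cps-correct M m c κ rewrite ⟦num⟧ m ∅ᵉ =
    trans (foldTree->>= (⟦ M ⟧ ∅ᵉ) _ c κ)
      (cps-related M ∅ᵉ ∅ᵀ (λ ()) c _ _ λ f f′ c′ rf →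
        rf m m refl c′ κ κ λ x y c″ rxy → cong (λ z → κ z c″) rxy)

fromℕ : ℕ → ℚ
fromℕ a = + a / 1

fromℕ≡mkℚ : ∀ a → fromℕ a ≡ mkℚ (+ a) 0 (coprime-sym (1-coprimeTo a))
fromℕ≡mkℚ a = ℚP.normalize-coprime (coprime-sym (1-coprimeTo a))

fromℕ-suc : ∀ a → fromℕ (suc a) ≡ 1ℚ + fromℕ a
fromℕ-suc a = trans (cong (λ z → (+ 1 +ℤ z) / 1) (sym (ℤP.*-identityʳ (+ a))))
                    (cong (λ q → 1ℚ + q) (sym (fromℕ≡mkℚ a)))

fromℕ-+ : ∀ a b → fromℕ (a +ℕ b) ≡ fromℕ a + fromℕ b
fromℕ-+ zero    b = sym (ℚP.+-identityˡ (fromℕ b))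
fromℕ-+ (suc a) b = begin
  fromℕ (suc (a +ℕ b))         ≡⟨ fromℕ-suc (a +ℕ b) ⟩
  1ℚ + fromℕ (a +ℕ b)          ≡⟨ cong (λ q → 1ℚ + q) (fromℕ-+ a b) ⟩
  1ℚ + (fromℕ a + fromℕ b)     ≡⟨ sym (ℚP.+-assoc 1ℚ (fromℕ a) (fromℕ b)) ⟩
  (1ℚ + fromℕ a) + fromℕ b     ≡⟨ cong (_+ fromℕ b) (sym (fromℕ-suc a)) ⟩
  fromℕ (suc a) + fromℕ b      ∎
  where open ≡-Reasoning

fromℕ-* : ∀ a b → fromℕ (a *ℕ b) ≡ fromℕ a *ℚ fromℕ b
fromℕ-* zero    b = sym (ℚP.*-zeroˡ (fromℕ b))
fromℕ-* (suc a) b = begin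
  fromℕ (b +ℕ a *ℕ b)                   ≡⟨ fromℕ-+ b (a *ℕ b) ⟩
  fromℕ b + fromℕ (a *ℕ b)              ≡⟨ cong (λ q → fromℕ b + q) (fromℕ-* a b) ⟩
  fromℕ b + fromℕ a *ℚ fromℕ b          ≡⟨ cong (_+ fromℕ a *ℚ fromℕ b) (sym (ℚP.*-identityˡ (fromℕ b))) ⟩
  1ℚ *ℚ fromℕ b + fromℕ a *ℚ fromℕ b    ≡⟨ sym (ℚP.*-distribʳ-+ (fromℕ b) 1ℚ (fromℕ a)) ⟩
  (1ℚ + fromℕ a) *ℚ fromℕ b             ≡⟨ cong (_*ℚ fromℕ b) (sym (fromℕ-suc a)) ⟩
  fromℕ (suc a) *ℚ fromℕ b              ∎
  where open ≡-Reasoning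

0≤fromℕ : ∀ a → 0ℚ ≤ fromℕ a
0≤fromℕ a = ℚP.nonNegative⁻¹ (fromℕ a) {{ℚP.normalize-nonNeg a 1}}

p≤p+q : ∀ p {q} → 0ℚ ≤ q → p ≤ p + q
p≤p+q p {q} 0≤q = transport (_≤ p + q) (ℚP.+-identityʳ p) (ℚP.+-monoʳ-≤ p 0≤q)

p≤q⇒0≤q-p : ∀ {p q} → p ≤ q → 0ℚ ≤ q - p
p≤q⇒0≤q-p {p} {q} p≤q = transport (_≤ q - p) (ℚP.+-inverseʳ p) (ℚP.+-monoˡ-≤ (- p) p≤q)

fromℕ-mono-≤ : ∀ {a b} → a ≤ℕ b → fromℕ a ≤ fromℕ b
fromℕ-mono-≤ {a} {b} a≤b =
  transport (fromℕ a ≤_) a+[b∸a]≡b (p≤p+q (fromℕ a) (0≤fromℕ (b ∸ a)))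
  where
  a+[b∸a]≡b : fromℕ a + fromℕ (b ∸ a) ≡ fromℕ b
  a+[b∸a]≡b = trans (sym (fromℕ-+ a (b ∸ a))) (cong fromℕ (ℕP.m+[n∸m]≡n a≤b))

0≤p*q : ∀ {p q} → 0ℚ ≤ p → 0ℚ ≤ q → 0ℚ ≤ p *ℚ q
0≤p*q {p} {q} 0≤p 0≤q =
  ℚP.nonNegative⁻¹ (p *ℚ q) {{ℚP.nonNeg*nonNeg⇒nonNeg p {{nonNegative 0≤p}} q {{nonNegative 0≤q}}}}

*-monoʳ-≤-0≤ : ∀ r {p q} → 0ℚ ≤ r → p ≤ q → r *ℚ p ≤ r *ℚ q
*-monoʳ-≤-0≤ r 0≤r p≤q = ℚP.*-monoˡ-≤-nonNeg r {{nonNegative 0≤r}} p≤q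

half : ℚ
half = + 1 / 2

n<2^n : ∀ n → n <ℕ 2 ^ n
n<2^n zero    = ℕ.s≤s ℕ.z≤n
n<2^n (suc n) = transport (λ x → 2 +ℕ n ≤ℕ 2 ^ n +ℕ x) (sym (ℕP.+-identityʳ (2 ^ n)))
                          (ℕP.+-mono-≤ (ℕP.m^n>0 2 n) (n<2^n n))

0≤half^ : ∀ n → 0ℚ ≤ half^ n
0≤half^ zero    = ℚP.nonNegative⁻¹ 1ℚ
0≤half^ (suc n) = 0≤p*q (ℚP.nonNegative⁻¹ half) (0≤half^ n)

half^-monoʳ-≤ : ∀ n {p q} → p ≤ q → half^ n *ℚ p ≤ half^ n *ℚ q
half^-monoʳ-≤ n = *-monoʳ-≤-0≤ (half^ n) (0≤half^ n)

half^-+ : ∀ m n → half^ (m +ℕ n) ≡ half^ m *ℚ half^ n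
half^-+ zero    n = sym (ℚP.*-identityˡ (half^ n))
half^-+ (suc m) n = trans (cong (half *ℚ_) (half^-+ m n)) (sym (ℚP.*-assoc half (half^ m) (half^ n)))

2^e*half^e≡1 : ∀ e → fromℕ (2 ^ e) *ℚ half^ e ≡ 1ℚ
2^e*half^e≡1 zero    = refl
2^e*half^e≡1 (suc e) = begin
  fromℕ (2 *ℕ 2 ^ e) *ℚ (half *ℚ half^ e)       ≡⟨ cong (_*ℚ (half *ℚ half^ e)) (fromℕ-* 2 (2 ^ e)) ⟩
  (fromℕ 2 *ℚ fromℕ (2 ^ e)) *ℚ (half *ℚ half^ e) ≡⟨ regroup (fromℕ 2) (fromℕ (2 ^ e)) half (half^ e) ⟩
  (fromℕ 2 *ℚ half) *ℚ (fromℕ (2 ^ e) *ℚ half^ e) ≡⟨ cong ((fromℕ 2 *ℚ half) *ℚ_) (2^e*half^e≡1 e) ⟩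
  1ℚ                                               ∎
  where
  open ≡-Reasoning
  open +-*-Solver
  regroup : ∀ a b c d → (a *ℚ b) *ℚ (c *ℚ d) ≡ (a *ℚ c) *ℚ (b *ℚ d)
  regroup = solve 4 (λ a b c d → (a :* b) :* (c :* d) := (a :* c) :* (b :* d)) refl

half^≤1/n : ∀ n .{{_ : NonZero n}} → half^ n ≤ + 1 / n
half^≤1/n n@(suc n-1) = begin
  half^ n                         ≡⟨ sym (ℚP.*-identityʳ _) ⟩
  half^ n *ℚ 1ℚ                   ≡⟨ cong (half^ n *ℚ_) (sym n*1/n≡1) ⟩
  half^ n *ℚ (fromℕ n *ℚ 1/n)     ≡⟨ sym (ℚP.*-assoc (half^ n) (fromℕ n) 1/n) ⟩
  (half^ n *ℚ fromℕ n) *ℚ 1/n     ≤⟨ ℚP.*-monoʳ-≤-nonNeg 1/n {{nonNegative 0≤1/n}} half^n*n≤1 ⟩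
  1ℚ *ℚ 1/n                       ≡⟨ ℚP.*-identityˡ 1/n ⟩
  1/n                             ∎
  where
  open ℚP.≤-Reasoning
  1/n = + 1 / n
  1/n≡mkℚ : 1/n ≡ mkℚ (+ 1) n-1 (1-coprimeTo n)
  1/n≡mkℚ = ℚP.normalize-coprime (1-coprimeTo n)
  n*1/n≡1 : fromℕ n *ℚ 1/n ≡ 1ℚ
  n*1/n≡1 = trans (cong₂ _*ℚ_ (fromℕ≡mkℚ n) 1/n≡mkℚ)
                  (ℚP.*-inverseʳ (mkℚ (+ n) 0 (coprime-sym (1-coprimeTo n))))
  0≤1/n : 0ℚ ≤ 1/n
  0≤1/n = transport (0ℚ ≤_) (sym 1/n≡mkℚ) (ℚP.nonNegative⁻¹ (mkℚ (+ 1) n-1 _))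
  half^n*n≤1 : half^ n *ℚ fromℕ n ≤ 1ℚ
  half^n*n≤1 = begin
    half^ n *ℚ fromℕ n        ≤⟨ *-monoʳ-≤-0≤ (half^ n) (0≤half^ n) (fromℕ-mono-≤ (ℕP.<⇒≤ (n<2^n n))) ⟩
    half^ n *ℚ fromℕ (2 ^ n)  ≡⟨ ℚP.*-comm (half^ n) _ ⟩
    fromℕ (2 ^ n) *ℚ half^ n  ≡⟨ 2^e*half^e≡1 n ⟩
    1ℚ                        ∎

dyadic-+ : ∀ a e b f → dyadic (a *ℕ 2 ^ f +ℕ b *ℕ 2 ^ e) (e +ℕ f) ≡ dyadic a e + dyadic b f
dyadic-+ a e b f = begin
  fromℕ (a *ℕ 2 ^ f +ℕ b *ℕ 2 ^ e) *ℚ half^ (e +ℕ f)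
    ≡⟨ cong₂ _*ℚ_ (trans (fromℕ-+ (a *ℕ 2 ^ f) (b *ℕ 2 ^ e)) (cong₂ _+_ (fromℕ-* a (2 ^ f)) (fromℕ-* b (2 ^ e))))
                  (half^-+ e f) ⟩
  (fromℕ a *ℚ fromℕ (2 ^ f) + fromℕ b *ℚ fromℕ (2 ^ e)) *ℚ (half^ e *ℚ half^ f)
    ≡⟨ regroup (fromℕ a) (fromℕ b) (fromℕ (2 ^ f)) (fromℕ (2 ^ e)) (half^ e) (half^ f) ⟩
  fromℕ a *ℚ half^ e *ℚ (fromℕ (2 ^ f) *ℚ half^ f) + fromℕ b *ℚ half^ f *ℚ (fromℕ (2 ^ e) *ℚ half^ e)
    ≡⟨ cong₂ (λ x y → fromℕ a *ℚ half^ e *ℚ x + fromℕ b *ℚ half^ f *ℚ y) (2^e*half^e≡1 f) (2^e*half^e≡1 e) ⟩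
  fromℕ a *ℚ half^ e *ℚ 1ℚ + fromℕ b *ℚ half^ f *ℚ 1ℚ
    ≡⟨ cong₂ _+_ (ℚP.*-identityʳ (dyadic a e)) (ℚP.*-identityʳ (dyadic b f)) ⟩
  dyadic a e + dyadic b f ∎
  where
  open ≡-Reasoning
  open +-*-Solver
  regroup : ∀ a b p q x y → (a *ℚ p + b *ℚ q) *ℚ (x *ℚ y) ≡ a *ℚ x *ℚ (p *ℚ y) + b *ℚ y *ℚ (q *ℚ x)
  regroup = solve 6 (λ a b p q x y → (a :* p :+ b :* q) :* (x :* y) := a :* x :* (p :* y) :+ b :* y :* (q :* x)) refl

dyadic-shift : ∀ b f i → dyadic b (f +ℕ suc i) ≡ half^ (suc i) *ℚ dyadic b f
dyadic-shift b f i = begin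
  fromℕ b *ℚ half^ (f +ℕ suc i)            ≡⟨ cong (fromℕ b *ℚ_) (half^-+ f (suc i)) ⟩
  fromℕ b *ℚ (half^ f *ℚ half^ (suc i))    ≡⟨ rotate (fromℕ b) (half^ f) (half^ (suc i)) ⟩
  half^ (suc i) *ℚ (fromℕ b *ℚ half^ f)    ∎
  where
  open ≡-Reasoning
  open +-*-Solver
  rotate : ∀ a b c → a *ℚ (b *ℚ c) ≡ c *ℚ (a *ℚ b)
  rotate = solve 3 (λ a b c → a :* (b :* c) := c :* (a :* b)) refl

sumTo-cong : ∀ n (f g : ℕ → ℚ) → (∀ i → i <ℕ n → f i ≡ g i) → sumTo n f ≡ sumTo n g
sumTo-cong zero    f g e = refl
sumTo-cong (suc n) f g e =
  cong₂ _+_ (sumTo-cong n f g (λ i i<n → e i (ℕP.m≤n⇒m≤1+n i<n))) (e n ℕP.≤-refl)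

sumTo-mono-≤ : ∀ n (f g : ℕ → ℚ) → (∀ i → i <ℕ n → f i ≤ g i) → sumTo n f ≤ sumTo n g
sumTo-mono-≤ zero    f g e = ℚP.≤-refl
sumTo-mono-≤ (suc n) f g e =
  ℚP.+-mono-≤ (sumTo-mono-≤ n f g (λ i i<n → e i (ℕP.m≤n⇒m≤1+n i<n))) (e n ℕP.≤-refl)

sumTo-0 : ∀ n → sumTo n (λ _ → 0ℚ) ≡ 0ℚ
sumTo-0 zero    = refl
sumTo-0 (suc n) = trans (ℚP.+-identityʳ (sumTo n (λ _ → 0ℚ))) (sumTo-0 n)

0≤sumTo : ∀ n (f : ℕ → ℚ) → (∀ i → 0ℚ ≤ f i) → 0ℚ ≤ sumTo n f
0≤sumTo n f 0≤f = transport (_≤ sumTo n f) (sumTo-0 n) (sumTo-mono-≤ n (λ _ → 0ℚ) f (λ i _ → 0≤f i))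

sumTo-monoˡ-≤ : ∀ {n m} (f : ℕ → ℚ) → n ≤ℕ m → (∀ i → 0ℚ ≤ f i) → sumTo n f ≤ sumTo m f
sumTo-monoˡ-≤ {m = zero}  f ℕ.z≤n 0≤f = ℚP.≤-refl
sumTo-monoˡ-≤ {m = suc m} f n≤1+m 0≤f with ℕP.m≤n⇒m<n∨m≡n n≤1+m
... | inj₁ n<1+m = ℚP.≤-trans (sumTo-monoˡ-≤ f (ℕP.≤-pred n<1+m) 0≤f) (p≤p+q (sumTo m f) (0≤f m))
... | inj₂ refl  = ℚP.≤-refl

sumTo-+ : ∀ n (f g : ℕ → ℚ) → sumTo n (λ i → f i + g i) ≡ sumTo n f + sumTo n g
sumTo-+ zero    f g = refl
sumTo-+ (suc n) f g =
  trans (cong (_+ (f n + g n)) (sumTo-+ n f g)) (interchange (sumTo n f) (sumTo n g) (f n) (g n))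
  where
  open +-*-Solver
  interchange : ∀ a b c d → (a + b) + (c + d) ≡ (a + c) + (b + d)
  interchange = solve 4 (λ a b c d → (a :+ b) :+ (c :+ d) := (a :+ c) :+ (b :+ d)) refl

sumTo-difference : ∀ n (f g : ℕ → ℚ) → sumTo n (λ i → f i - g i) ≡ sumTo n f - sumTo n g
sumTo-difference zero    f g = refl
sumTo-difference (suc n) f g =
  trans (cong (_+ (f n - g n)) (sumTo-difference n f g)) (interchange (sumTo n f) (sumTo n g) (f n) (g n))
  where
  open +-*-Solver
  interchange : ∀ a b c d → (a - b) + (c - d) ≡ (a + c) - (b + d)
  interchange = solve 4 (λ a b c d → (a :- b) :+ (c :- d) := (a :+ c) :- (b :+ d)) refl

*-distribˡ-sumTo : ∀ n a (f : ℕ → ℚ) → sumTo n (λ i → a *ℚ f i) ≡ a *ℚ sumTo n f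
*-distribˡ-sumTo zero    a f = sym (ℚP.*-zeroʳ a)
*-distribˡ-sumTo (suc n) a f =
  trans (cong (_+ a *ℚ f n) (*-distribˡ-sumTo n a f)) (sym (ℚP.*-distribˡ-+ a (sumTo n f) (f n)))

sumTo-comm : ∀ K N (g : ℕ → ℕ → ℚ) →
             sumTo K (λ k → sumTo N (λ i → g i k)) ≡ sumTo N (λ i → sumTo K (g i))
sumTo-comm zero    N g = sym (sumTo-0 N)
sumTo-comm (suc K) N g = trans (cong (_+ sumTo N (λ i → g i K)) (sumTo-comm K N g))
                               (sym (sumTo-+ N (λ i → sumTo K (g i)) (λ i → g i K)))

sumTo-half^ : ∀ n → sumTo n (λ i → half^ (suc i)) ≡ 1ℚ - half^ n
sumTo-half^ zero    = refl
sumTo-half^ (suc n) = begin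
  sumTo n (λ i → half^ (suc i)) + half *ℚ x   ≡⟨ cong (_+ half *ℚ x) (sumTo-half^ n) ⟩
  (1ℚ - x) + half *ℚ x                       ≡⟨ cong (λ z → (1ℚ - z) + half *ℚ x) (sym (ℚP.*-identityˡ x)) ⟩
  (1ℚ - (half + half) *ℚ x) + half *ℚ x      ≡⟨ cancel half x ⟩
  1ℚ - half *ℚ x                             ∎
  where
  open ≡-Reasoning
  open +-*-Solver
  x = half^ n
  cancel : ∀ h y → (1ℚ - (h + h) *ℚ y) + h *ℚ y ≡ 1ℚ - h *ℚ y
  cancel = solve 2 (λ h y → (con 1ℚ :- (h :+ h) :* y) :+ h :* y := con 1ℚ :- h :* y) refl

1-half^≤1 : ∀ n → 1ℚ - half^ n ≤ 1ℚ
1-half^≤1 n = transport (1ℚ - half^ n ≤_) (cancel (half^ n)) (p≤p+q (1ℚ - half^ n) (0≤half^ n))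
  where
  open +-*-Solver
  cancel : ∀ y → (1ℚ - y) + y ≡ 1ℚ
  cancel = solve 1 (λ y → (con 1ℚ :- y) :+ y := con 1ℚ) refl

plusᵀ : TTerm Γ (Nat ⇒ Nat ⇒ Nat)
plusᵀ = tlam (tlam (tapp trec (tpair #0 (tpair (tlam (tlam (tapp tsuc #0))) #1))))

⟦plus⟧ : (η : Envᵀ Γ) → ∀ x y → ⟦ plusᵀ ⟧ᵀ η x y ≡ x +ℕ y
⟦plus⟧ η zero    y = refl
⟦plus⟧ η (suc x) y = cong suc (⟦plus⟧ η x y)

timesᵀ : TTerm Γ (Nat ⇒ Nat ⇒ Nat)
timesᵀ = tlam (tlam (tapp trec (tpair tzer (tpair (tlam (tlam (tapp (tapp plusᵀ #2) #0))) #1))))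

⟦times⟧ : (η : Envᵀ Γ) → ∀ x y → ⟦ timesᵀ ⟧ᵀ η x y ≡ x *ℕ y
⟦times⟧ η zero    y = refl
⟦times⟧ η (suc x) y =
  trans (⟦plus⟧ (⟦ timesᵀ ⟧ᵀ η x y ∷ᵀ (x ∷ᵀ (y ∷ᵀ (suc x ∷ᵀ η)))) y (⟦ timesᵀ ⟧ᵀ η x y))
        (cong (y +ℕ_) (⟦times⟧ η x y))

pow2ᵀ : TTerm Γ (Nat ⇒ Nat)
pow2ᵀ = tlam (tapp trec (tpair (tnum 1) (tpair (tlam (tlam (tapp (tapp timesᵀ (tnum 2)) #0))) #0)))

⟦pow2⟧ : (η : Envᵀ Γ) → ∀ e → ⟦ pow2ᵀ ⟧ᵀ η e ≡ 2 ^ e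
⟦pow2⟧ η zero    = refl
⟦pow2⟧ η (suc e) =
  trans (⟦times⟧ (⟦ pow2ᵀ ⟧ᵀ η e ∷ᵀ (e ∷ᵀ (suc e ∷ᵀ η))) 2 (⟦ pow2ᵀ ⟧ᵀ η e)) (cong (2 *ℕ_) (⟦pow2⟧ η e))

val : ℕ × ℕ → ℚ
val (a , e) = dyadic a e

-- ⟨a , e⟩ + ⟨b , f⟩ = ⟨a 2^f + b 2^e , e + f⟩
addᵀ : TTerm Γ (BIN ⇒ BIN ⇒ BIN)
addᵀ = tlam (tlam (tpair
  (tapp (tapp plusᵀ (tapp (tapp timesᵀ (tapp tpi1 #1)) (tapp pow2ᵀ (tapp tpi2 #0))))
                    (tapp (tapp timesᵀ (tapp tpi1 #0)) (tapp pow2ᵀ (tapp tpi2 #1))))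
  (tapp (tapp plusᵀ (tapp tpi2 #1)) (tapp tpi2 #0))))

val-add : (η : Envᵀ Γ) → ∀ p q → val (⟦ addᵀ ⟧ᵀ η p q) ≡ val p + val q
val-add η (a , e) (b , f) = begin
  val (⟦ addᵀ ⟧ᵀ η (a , e) (b , f))
    ≡⟨ cong₂ dyadic
        (trans (⟦plus⟧ η′ (⟦ timesᵀ ⟧ᵀ η′ a (⟦ pow2ᵀ ⟧ᵀ η′ f)) (⟦ timesᵀ ⟧ᵀ η′ b (⟦ pow2ᵀ ⟧ᵀ η′ e)))
               (cong₂ _+ℕ_ (trans (⟦times⟧ η′ a (⟦ pow2ᵀ ⟧ᵀ η′ f)) (cong (a *ℕ_) (⟦pow2⟧ η′ f)))
                           (trans (⟦times⟧ η′ b (⟦ pow2ᵀ ⟧ᵀ η′ e)) (cong (b *ℕ_) (⟦pow2⟧ η′ e)))))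
        (⟦plus⟧ η′ e f) ⟩
  dyadic (a *ℕ 2 ^ f +ℕ b *ℕ 2 ^ e) (e +ℕ f)
    ≡⟨ dyadic-+ a e b f ⟩
  dyadic a e + dyadic b f ∎
  where
  open ≡-Reasoning
  η′ : Envᵀ (BIN ∷ BIN ∷ _)
  η′ = (b , f) ∷ᵀ ((a , e) ∷ᵀ η)

shiftᵀ : TTerm Γ (Nat ⇒ BIN ⇒ BIN)
shiftᵀ = tlam (tlam (tpair (tapp tpi1 #0) (tapp (tapp plusᵀ (tapp tpi2 #0)) (tapp tsuc #1))))

val-shift : (η : Envᵀ Γ) → ∀ i q → val (⟦ shiftᵀ ⟧ᵀ η i q) ≡ half^ (suc i) *ℚ val q
val-shift η i (b , f) =
  trans (cong (dyadic b) (⟦plus⟧ ((b , f) ∷ᵀ (i ∷ᵀ η)) f (suc i))) (dyadic-shift b f i)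

weightedSumᵀ : TTerm Γ (Nat ⇒ (Nat ⇒ BIN) ⇒ BIN)
weightedSumᵀ = tlam (tlam (tapp trec (tpair (tpair tzer tzer)
  (tpair (tlam (tlam (tapp (tapp addᵀ #0) (tapp (tapp shiftᵀ #1) (tapp #2 #1))))) #1))))

weightedSum : ℕ → (ℕ → ℕ × ℕ) → ℕ × ℕ
weightedSum = ⟦ weightedSumᵀ {[]} ⟧ᵀ ∅ᵀ

val-weightedSum : ∀ n h → val (weightedSum n h) ≡ sumTo n (λ i → half^ (suc i) *ℚ val (h i))
val-weightedSum zero    h = refl
val-weightedSum (suc n) h =
  trans (val-add η (weightedSum n h) (⟦ shiftᵀ ⟧ᵀ η n (h n)))
        (cong₂ _+_ (val-weightedSum n h) (val-shift η n (h n)))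
  where
  η : Envᵀ (BIN ∷ Nat ∷ (Nat ⇒ BIN) ∷ Nat ∷ [])
  η = weightedSum n h ∷ᵀ (n ∷ᵀ (h ∷ᵀ (suc n ∷ᵀ ∅ᵀ)))

weightedSum-cong : ∀ n (h h′ : ℕ → ℕ × ℕ) → (∀ i → h i ≡ h′ i) → weightedSum n h ≡ weightedSum n h′
weightedSum-cong zero    h h′ e = refl
weightedSum-cong (suc n) h h′ e =
  cong₂ (λ acc x → ⟦ addᵀ {[]} ⟧ᵀ ∅ᵀ acc (⟦ shiftᵀ {[]} ⟧ᵀ ∅ᵀ n x)) (weightedSum-cong n h h′ e) (e n)

maxᵀ : TTerm Γ (Nat ⇒ Nat ⇒ Nat)
maxᵀ = tlam (tapp trec (tpair (tlam #0) (tpair (tlam (tlam (tlam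
  (tapp trec (tpair (tapp tsuc #2) (tpair (tlam (tlam (tapp tsuc (tapp #3 #1)))) #0)))))) #0)))

⟦max⟧ : (η : Envᵀ Γ) → ∀ x y → ⟦ maxᵀ ⟧ᵀ η x y ≡ x ⊔ y
⟦max⟧ η zero    y       = refl
⟦max⟧ η (suc x) zero    = refl
⟦max⟧ η (suc x) (suc y) = cong suc (⟦max⟧ η x y)

maxBelowᵀ : TTerm Γ (Nat ⇒ (Nat ⇒ Nat) ⇒ Nat)
maxBelowᵀ = tlam (tlam (tapp trec (tpair tzer (tpair (tlam (tlam (tapp (tapp maxᵀ #0) (tapp #2 #1)))) #1))))

maxBelow : ℕ → (ℕ → ℕ) → ℕ
maxBelow = ⟦ maxBelowᵀ {[]} ⟧ᵀ ∅ᵀ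

maxBelow-upper : ∀ n (h : ℕ → ℕ) i → i <ℕ n → h i ≤ℕ maxBelow n h
maxBelow-upper (suc n) h i i<1+n
  rewrite ⟦max⟧ (maxBelow n h ∷ᵀ (n ∷ᵀ (h ∷ᵀ (suc n ∷ᵀ ∅ᵀ)))) (maxBelow n h) (h n)
  with ℕP.m≤n⇒m<n∨m≡n (ℕP.≤-pred i<1+n)
... | inj₁ i<n  = ℕP.≤-trans (maxBelow-upper n h i i<n) (ℕP.m≤m⊔n (maxBelow n h) (h n))
... | inj₂ refl = ℕP.m≤n⊔m (maxBelow n h) (h n)

maxBelow-cong : ∀ n (h h′ : ℕ → ℕ) → (∀ i → h i ≡ h′ i) → maxBelow n h ≡ maxBelow n h′
maxBelow-cong zero    h h′ e = refl
maxBelow-cong (suc n) h h′ e = cong₂ (⟦ maxᵀ {[]} ⟧ᵀ ∅ᵀ) (maxBelow-cong n h h′ e) (e n)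

-- a node at counter c keeps its first c + 1 children
module Mass = CPS BIN (tlam (tlam (tapp (tapp weightedSumᵀ (tapp tsuc #1)) #0)))
  (λ c → weightedSum (suc c)) (λ η c h → refl) (λ c → weightedSum-cong (suc c))
module Bound = CPS Nat (tlam (tlam (tapp (tapp maxBelowᵀ (tapp tsuc #1)) #0)))
  (λ c → maxBelow (suc c)) (λ η c h → refl) (λ c → maxBelow-cong (suc c))

eqᵀ : TTerm Γ (Nat ⇒ Nat ⇒ Nat)
eqᵀ = tlam (tapp trec (tpair (tlam (tapp trec (tpair (tnum 1) (tpair (tlam (tlam tzer)) #0))))
  (tpair (tlam (tlam (tlam (tapp trec (tpair tzer (tpair (tlam (tlam (tapp #3 #1))) #0)))))) #0)))

val-eq : ∀ v k → val (⟦ eqᵀ {[]} ⟧ᵀ ∅ᵀ v k , 0) ≡ ind (isNum (num v) k)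
val-eq zero    zero    = refl
val-eq zero    (suc k) = refl
val-eq (suc v) zero    = refl
val-eq (suc v) (suc k) = val-eq v k

isNum-sound : (M : Closed Nat) (k : ℕ) → isNum M k ≡ true → M ≡ num k
isNum-sound zer zero e = refl
isNum-sound (app suc′ M) (suc k) e = cong (app suc′) (isNum-sound M k e)
isNum-sound zer (suc k) ()
isNum-sound R k ()
isNum-sound (app suc′ M) zero ()
isNum-sound (app (lam _) _) k ()
isNum-sound (app (app _ _) _) k ()
isNum-sound (app pi1 _) k ()
isNum-sound (app pi2 _) k ()
isNum-sound (app rec _) k ()

num-injective : ∀ a b → num {[]} a ≡ num b → a ≡ b
num-injective zero    zero    e = refl
num-injective (suc a) (suc b) e = cong suc (num-injective a b (cong predecessor e))
  where
  predecessor : Closed Nat → Closed Nat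
  predecessor (app {Nat} _ M) = M
  predecessor M               = M

0≤ind : ∀ b → 0ℚ ≤ ind b
0≤ind true  = ℚP.nonNegative⁻¹ 1ℚ
0≤ind false = ℚP.≤-refl

AtMostOne : (ℕ → Bool) → Set
AtMostOne b = ∀ {k k′} → b k ≡ true → b k′ ≡ true → k ≡ k′

isNum-atMostOne : (M : Closed Nat) → AtMostOne (isNum M)
isNum-atMostOne M {k} {k′} e e′ = num-injective k k′ (trans (sym (isNum-sound M k e)) (isNum-sound M k′ e′))

isNum-num : ∀ v → isNum (num v) v ≡ true
isNum-num zero    = refl
isNum-num (suc v) = isNum-num v

module _ {b : ℕ → Bool} (unique : AtMostOne b) where

  others-false : ∀ {v} → b v ≡ true → ∀ k → k ≢ v → b k ≡ false
  others-false bv k k≢v with b k in bk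
  ... | true  = ⊥-elim (k≢v (unique bk bv))
  ... | false = refl

  sumTo-ind-0 : ∀ {v} → b v ≡ true → ∀ n → n ≤ℕ v → sumTo n (λ k → ind (b k)) ≡ 0ℚ
  sumTo-ind-0 bv n n≤v = trans (sumTo-cong n _ _ λ k k<n → cong ind (others-false bv k (k≢v k<n))) (sumTo-0 n)
    where
    k≢v : ∀ {k} → k <ℕ n → k ≢ _
    k≢v k<n refl = ℕP.<-irrefl refl (ℕP.<-≤-trans k<n n≤v)

  sumTo-ind-1 : ∀ {v} → b v ≡ true → ∀ n → v <ℕ n → sumTo n (λ k → ind (b k)) ≡ 1ℚ
  sumTo-ind-1 {v} bv (suc n) v<1+n with ℕP.m≤n⇒m<n∨m≡n (ℕP.≤-pred v<1+n)
  ... | inj₁ v<n  rewrite others-false bv n (ℕP.>⇒≢ v<n) =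
    trans (ℚP.+-identityʳ _) (sumTo-ind-1 bv n v<n)
  ... | inj₂ refl rewrite bv | sumTo-ind-0 bv n ℕP.≤-refl = refl

  sumTo-ind-≤1 : ∀ n → sumTo n (λ k → ind (b k)) ≤ 1ℚ
  sumTo-ind-≤1 zero = ℚP.nonNegative⁻¹ 1ℚ
  sumTo-ind-≤1 (suc n) with b n in bn
  ... | false = transport (_≤ 1ℚ) (sym (ℚP.+-identityʳ _)) (sumTo-ind-≤1 n)
  ... | true  = ℚP.≤-reflexive (cong (_+ 1ℚ) (sumTo-ind-0 bn n ℕP.≤-refl))

trunc-stop : {M : Closed Nat} → step M ≡ stop → ∀ j N k → trunc j N M k ≡ ind (isNum M k)
trunc-stop st zero    N k = refl
trunc-stop st (suc j) N k rewrite st = refl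

trunc-det : {M M′ : Closed Nat} → step M ≡ det M′ → ∀ j N k → trunc (suc j) N M k ≡ trunc j N M′ k
trunc-det eq j N k rewrite eq = refl

trunc-rnd : {M : Closed Nat} {g : ℕ → Closed Nat} → step M ≡ rnd g → ∀ j N k →
            trunc (suc j) N M k ≡ sumTo N (λ i → half^ (suc i) *ℚ trunc j N (g i) k)
trunc-rnd eq j N k rewrite eq = refl

trunc-steps : ∀ {d} {M M′ : Closed Nat} → Steps d M M′ → ∀ {j} N k → d ≤ℕ j →
              trunc j N M k ≡ trunc (j ∸ d) N M′ k
trunc-steps done                N k d≤j = refl
trunc-steps (more {M = M} eq s) {suc j} N k (ℕ.s≤s d≤j) =
  trans (trunc-det {M = M} eq j N k) (trunc-steps s N k d≤j)

0≤trunc : ∀ j N (M : Closed Nat) k → 0ℚ ≤ trunc j N M k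
0≤trunc zero    N M k = 0≤ind (isNum M k)
0≤trunc (suc j) N M k with step M
... | stop   = 0≤ind (isNum M k)
... | det M′ = 0≤trunc j N M′ k
... | rnd g  = 0≤sumTo N _ λ i → 0≤p*q (0≤half^ (suc i)) (0≤trunc j N (g i) k)

sumTo-trunc≤1 : ∀ j N (M : Closed Nat) K → sumTo K (trunc j N M) ≤ 1ℚ
sumTo-trunc≤1 zero    N M K = sumTo-ind-≤1 (isNum-atMostOne M) K
sumTo-trunc≤1 (suc j) N M K with step M
... | stop   = sumTo-ind-≤1 (isNum-atMostOne M) K
... | det M′ = sumTo-trunc≤1 j N M′ K
... | rnd g  = begin
  sumTo K (λ k → sumTo N (λ i → half^ (suc i) *ℚ trunc j N (g i) k))
    ≡⟨ sumTo-comm K N (λ i k → half^ (suc i) *ℚ trunc j N (g i) k) ⟩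
  sumTo N (λ i → sumTo K (λ k → half^ (suc i) *ℚ trunc j N (g i) k))
    ≡⟨ sumTo-cong N _ _ (λ i _ → *-distribˡ-sumTo K (half^ (suc i)) (trunc j N (g i))) ⟩
  sumTo N (λ i → half^ (suc i) *ℚ sumTo K (trunc j N (g i)))
    ≤⟨ sumTo-mono-≤ N _ _ (λ i _ → half^-monoʳ-≤ (suc i) (sumTo-trunc≤1 j N (g i) K)) ⟩
  sumTo N (λ i → half^ (suc i) *ℚ 1ℚ)
    ≡⟨ sumTo-cong N _ _ (λ i _ → ℚP.*-identityʳ (half^ (suc i))) ⟩
  sumTo N (λ i → half^ (suc i))
    ≡⟨ sumTo-half^ N ⟩
  1ℚ - half^ N
    ≤⟨ 1-half^≤1 N ⟩
  1ℚ ∎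
  where open ℚP.≤-Reasoning

-- The pruned distribution of a tree

ν : Tree ℕ → ℕ → ℕ → ℚ
ν (leaf v) c k = ind (isNum (num v) k)
ν (node f) c k = sumTo (suc c) (λ i → half^ (suc i) *ℚ ν (f i) (suc c) k)

mass : Tree ℕ → ℕ → ℚ
mass (leaf v) c = 1ℚ
mass (node f) c = sumTo (suc c) (λ i → half^ (suc i) *ℚ mass (f i) (suc c))

bound : Tree ℕ → ℕ → ℕ
bound t c = Bound.foldTree t c (λ v _ → suc v)

bound-node : ∀ f c i → i <ℕ suc c → bound (f i) (suc c) ≤ℕ bound (node f) c
bound-node f c = maxBelow-upper (suc c) (λ i → bound (f i) (suc c))

val-foldTree : ∀ t c k → val (Mass.foldTree t c (λ v _ → ⟦ eqᵀ ⟧ᵀ ∅ᵀ v k , 0)) ≡ ν t c k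
val-foldTree (leaf v) c k = val-eq v k
val-foldTree (node f) c k =
  trans (val-weightedSum (suc c) (λ i → Mass.foldTree (f i) (suc c) (λ v _ → ⟦ eqᵀ ⟧ᵀ ∅ᵀ v k , 0)))
        (sumTo-cong (suc c) _ _ λ i _ → cong (half^ (suc i) *ℚ_) (val-foldTree (f i) (suc c) k))

ν-vanish : ∀ t c k → bound t c ≤ℕ k → ν t c k ≡ 0ℚ
ν-vanish (leaf v) c k v<k = cong ind (others-false (isNum-atMostOne (num v)) (isNum-num v) k (ℕP.>⇒≢ v<k))
ν-vanish (node f) c k bound≤k =
  trans (sumTo-cong (suc c) _ _ λ i i≤c →
           trans (cong (half^ (suc i) *ℚ_) (ν-vanish (f i) (suc c) k (ℕP.≤-trans (bound-node f c i i≤c) bound≤k)))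
                 (ℚP.*-zeroʳ (half^ (suc i))))
        (sumTo-0 (suc c))

sumTo-ν : ∀ t c K → bound t c ≤ℕ K → sumTo K (ν t c) ≡ mass t c
sumTo-ν (leaf v) c K v<K = sumTo-ind-1 (isNum-atMostOne (num v)) (isNum-num v) K v<K
sumTo-ν (node f) c K bound≤K = begin
  sumTo K (λ k → sumTo (suc c) (λ i → half^ (suc i) *ℚ ν (f i) (suc c) k))
    ≡⟨ sumTo-comm K (suc c) (λ i k → half^ (suc i) *ℚ ν (f i) (suc c) k) ⟩
  sumTo (suc c) (λ i → sumTo K (λ k → half^ (suc i) *ℚ ν (f i) (suc c) k))
    ≡⟨ sumTo-cong (suc c) _ _ (λ i i≤c → trans (*-distribˡ-sumTo K (half^ (suc i)) (ν (f i) (suc c)))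
         (cong (half^ (suc i) *ℚ_) (sumTo-ν (f i) (suc c) K (ℕP.≤-trans (bound-node f c i i≤c) bound≤K)))) ⟩
  mass (node f) c ∎
  where open ≡-Reasoning

-- With x = 2^-(c+1): the children carry weight 1 - x and by induction mass ≥ 1 - x each,
-- and (1 - x)² ≥ 1 - 2x.
mass-lower : ∀ t c → 1ℚ - half^ c ≤ mass t c
mass-lower (leaf v) c = 1-half^≤1 c
mass-lower (node f) c = begin
  1ℚ - half^ c                      ≡⟨ cong (λ z → 1ℚ - z) (sym x+x≡half^c) ⟩
  1ℚ - (x + x)                      ≤⟨ p≤p+q (1ℚ - (x + x)) (0≤p*q {x} {x} (0≤half^ (suc c)) (0≤half^ (suc c))) ⟩
  1ℚ - (x + x) + x *ℚ x             ≡⟨ square x ⟩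
  (1ℚ - x) *ℚ (1ℚ - x)              ≡⟨ cong (_*ℚ (1ℚ - x)) (sym (sumTo-half^ (suc c))) ⟩
  sumTo (suc c) (λ i → half^ (suc i)) *ℚ (1ℚ - x)
    ≡⟨ trans (ℚP.*-comm _ (1ℚ - x)) (sym (*-distribˡ-sumTo (suc c) (1ℚ - x) (λ i → half^ (suc i)))) ⟩
  sumTo (suc c) (λ i → (1ℚ - x) *ℚ half^ (suc i))
    ≡⟨ sumTo-cong (suc c) _ _ (λ i _ → ℚP.*-comm (1ℚ - x) (half^ (suc i))) ⟩
  sumTo (suc c) (λ i → half^ (suc i) *ℚ (1ℚ - x))
    ≤⟨ sumTo-mono-≤ (suc c) _ _ (λ i _ → half^-monoʳ-≤ (suc i) (mass-lower (f i) (suc c))) ⟩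
  mass (node f) c ∎
  where
  open ℚP.≤-Reasoning
  open +-*-Solver
  x = half^ (suc c)
  x+x≡half^c : x + x ≡ half^ c
  x+x≡half^c = trans (sym (ℚP.*-distribʳ-+ (half^ c) half half)) (ℚP.*-identityˡ (half^ c))
  square : ∀ y → 1ℚ - (y + y) + y *ℚ y ≡ (1ℚ - y) *ℚ (1ℚ - y)
  square = solve 1 (λ y → con 1ℚ :- (y :+ y) :+ y :* y := (con 1ℚ :- y) :* (con 1ℚ :- y)) refl

ν-node≤trunc-rnd : ∀ {f : ℕ → Tree ℕ} {c} {M : Closed Nat} {g : ℕ → Closed Nat} {j N k} →
  step M ≡ rnd g → suc c ≤ℕ N →
  (∀ i → i <ℕ suc c → ν (f i) (suc c) k ≤ trunc j N (g i) k) →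
  ν (node f) c k ≤ trunc (suc j) N M k
ν-node≤trunc-rnd {f} {c} {M} {g} {j} {N} {k} eq c<N ν≤ = begin
  sumTo (suc c) (λ i → half^ (suc i) *ℚ ν (f i) (suc c) k)
    ≤⟨ sumTo-mono-≤ (suc c) _ _ (λ i i≤c → half^-monoʳ-≤ (suc i) (ν≤ i i≤c)) ⟩
  sumTo (suc c) (λ i → half^ (suc i) *ℚ trunc j N (g i) k)
    ≤⟨ sumTo-monoˡ-≤ _ c<N (λ i → 0≤p*q (0≤half^ (suc i)) (0≤trunc j N (g i) k)) ⟩
  sumTo N (λ i → half^ (suc i) *ℚ trunc j N (g i) k)
    ≡⟨ sym (trunc-rnd {M = M} eq j N k) ⟩
  trunc (suc j) N M k ∎
  where open ℚP.≤-Reasoning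

ν≤trunc : (t : Tree ℕ) (M : Closed Nat) (c : ℕ) → M ≈ᵗ t →
          ∃ λ J → ∀ j N k → J ≤ℕ j → J ≤ℕ N → ν t c k ≤ trunc j N M k
ν≤trunc (leaf v) M c (d , V , s , st , refl) = d , λ j N k d≤j _ →
  ℚP.≤-reflexive (sym (trans (trunc-steps s N k d≤j) (trunc-stop st (j ∸ d) N k)))
ν≤trunc (node f) M c (d , M′ , s , g , eq , h) = suc X +ℕ d , lower
  where
  J : ℕ → ℕ
  J i = proj₁ (ν≤trunc (f i) (g i) (suc c) (h i))
  X = maxBelow (suc c) J ⊔ suc c
  J≤X : ∀ i → i <ℕ suc c → J i ≤ℕ X
  J≤X i i≤c = ℕP.≤-trans (maxBelow-upper (suc c) J i i≤c) (ℕP.m≤m⊔n _ (suc c))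
  after-steps : ∀ j N k → X <ℕ j → X ≤ℕ N → ν (node f) c k ≤ trunc j N M′ k
  after-steps (suc j) N k (ℕ.s≤s X≤j) X≤N =
    ν-node≤trunc-rnd {f = f} {M = M′} {j = j} eq (ℕP.≤-trans (ℕP.m≤n⊔m _ (suc c)) X≤N) λ i i≤c →
      proj₂ (ν≤trunc (f i) (g i) (suc c) (h i)) j N k
        (ℕP.≤-trans (J≤X i i≤c) X≤j) (ℕP.≤-trans (J≤X i i≤c) X≤N)
  lower : ∀ j N k → suc X +ℕ d ≤ℕ j → suc X +ℕ d ≤ℕ N → ν (node f) c k ≤ trunc j N M k
  lower j N k J≤j J≤N =
    transport (ν (node f) c k ≤_) (sym (trunc-steps s N k (ℕP.m+n≤o⇒n≤o (suc X) J≤j)))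
      (after-steps (j ∸ d) N k (ℕP.m+n≤o⇒m≤o∸n (suc X) J≤j)
                               (ℕP.≤-trans (ℕP.n≤1+n X) (ℕP.m+n≤o⇒m≤o (suc X) J≤N)))

sumTo-∣approx-ν∣≤half^ : (t : Tree ℕ) (M : Closed Nat) (c : ℕ) → M ≈ᵗ t →
  ∃ λ J → ∀ j → J ≤ℕ j → ∀ K → sumTo K (λ k → ∣ approx j M k - ν t c k ∣) ≤ half^ c
sumTo-∣approx-ν∣≤half^ t M c M≈t = J , distance
  where
  J = proj₁ (ν≤trunc t M c M≈t)
  distance : ∀ j → J ≤ℕ j → ∀ K → sumTo K (λ k → ∣ approx j M k - ν t c k ∣) ≤ half^ c
  distance j J≤j K = begin
    sumTo K (λ k → ∣ a k - ν t c k ∣)  ≡⟨ sumTo-cong K _ _ (λ k _ → ℚP.0≤p⇒∣p∣≡p (0≤a-ν k)) ⟩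
    sumTo K (λ k → a k - ν t c k)      ≤⟨ sumTo-monoˡ-≤ _ (ℕP.m≤m⊔n K (bound t c)) 0≤a-ν ⟩
    sumTo K′ (λ k → a k - ν t c k)     ≡⟨ sumTo-difference K′ a (ν t c) ⟩
    sumTo K′ a - sumTo K′ (ν t c)      ≡⟨ cong (λ z → sumTo K′ a - z) (sumTo-ν t c K′ (ℕP.m≤n⊔m K (bound t c))) ⟩
    sumTo K′ a - mass t c              ≤⟨ ℚP.+-monoˡ-≤ (- mass t c) (sumTo-trunc≤1 j j M K′) ⟩
    1ℚ - mass t c                      ≤⟨ ℚP.+-monoʳ-≤ 1ℚ (ℚP.neg-antimono-≤ (mass-lower t c)) ⟩
    1ℚ - (1ℚ - half^ c)                ≡⟨ cancel (half^ c) ⟩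
    half^ c                            ∎
    where
    open ℚP.≤-Reasoning
    open +-*-Solver using (solve; _:=_; con; _:-_)
    a = approx j M
    K′ = K ⊔ bound t c
    0≤a-ν : ∀ k → 0ℚ ≤ a k - ν t c k
    0≤a-ν k = p≤q⇒0≤q-p (proj₂ (ν≤trunc t M c M≈t) j j k J≤j J≤j)
    cancel : ∀ y → 1ℚ - (1ℚ - y) ≡ y
    cancel = solve 1 (λ y → con 1ℚ :- (con 1ℚ :- y) := y) refl

-- λ p m n k. p n (λ f c. f m c (λ v c′. ⟨eq v k , 0⟩))
readMassᵀ : TTerm Γ (Mass.C (Mass.tyᶜ (Nat ⇒ Nat)) ⇒ Nat ⇒ Nat ⇒ Nat ⇒ BIN)
readMassᵀ = tlam (tlam (tlam (tlam (tapp (tapp #3 #1)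
  (tlam (tlam (tapp (tapp (tapp #1 #4) #0) (tlam (tlam (tpair (tapp (tapp eqᵀ #1) #4) tzer))))))))))

-- λ p m n. p n (λ f c. f m c (λ v c′. suc v))
readBoundᵀ : TTerm Γ (Bound.C (Bound.tyᶜ (Nat ⇒ Nat)) ⇒ Nat ⇒ Nat ⇒ Nat)
readBoundᵀ = tlam (tlam (tlam (tapp (tapp #2 #0)
  (tlam (tlam (tapp (tapp (tapp #1 #3) #0) (tlam (tlam (tapp tsuc #1)))))))))

module Approximants (M : Closed (Nat ⇒ Nat)) where

  F : TTerm [] (Nat ⇒ Nat ⇒ Nat ⇒ BIN)
  F = tapp readMassᵀ (Mass.cps M)

  Q : TTerm [] (Nat ⇒ Nat ⇒ Nat)
  Q = tapp readBoundᵀ (Bound.cps M)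

  tree : ℕ → Tree ℕ
  tree m = ⟦ app M (num m) ⟧ ∅ᵉ

  val-F : ∀ m n k → val (⟦ F ⟧ᵀ ∅ᵀ m n k) ≡ ν (tree m) n k
  val-F m n k = trans (cong val (sym (Mass.cps-correct M m n (λ v _ → ⟦ eqᵀ ⟧ᵀ ∅ᵀ v k , 0))))
                      (val-foldTree (tree m) n k)

  ⟦Q⟧ : ∀ m n → ⟦ Q ⟧ᵀ ∅ᵀ m n ≡ bound (tree m) n
  ⟦Q⟧ m n = sym (Bound.cps-correct M m n (λ v _ → suc v))

  F-vanish : ∀ m n k → ⟦ Q ⟧ᵀ ∅ᵀ m n ≤ℕ k → val (⟦ F ⟧ᵀ ∅ᵀ m n k) ≡ 0ℚ
  F-vanish m n k Q≤k = trans (val-F m n k) (ν-vanish (tree m) n k (transport (_≤ℕ k) (⟦Q⟧ m n) Q≤k))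

  F-error : ∀ m n .{{_ : NonZero n}} K ε → 0ℚ < ε → ∃ λ J → ∀ j → J ≤ℕ j →
            sumTo K (λ k → ∣ approx j (app M (num m)) k - val (⟦ F ⟧ᵀ ∅ᵀ m n k) ∣) ≤ (+ 1 / n) + ε
  F-error m n K ε 0<ε = J , λ j J≤j → begin
    sumTo K (λ k → ∣ approx j (app M (num m)) k - val (⟦ F ⟧ᵀ ∅ᵀ m n k) ∣)
      ≡⟨ sumTo-cong K _ _ (λ k _ → cong (λ z → ∣ approx j (app M (num m)) k - z ∣) (val-F m n k)) ⟩
    sumTo K (λ k → ∣ approx j (app M (num m)) k - ν (tree m) n k ∣)
      ≤⟨ distance j J≤j K ⟩
    half^ n    ≤⟨ half^≤1/n n ⟩
    + 1 / n    ≤⟨ p≤p+q (+ 1 / n) (ℚP.<⇒≤ 0<ε) ⟩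
    + 1 / n + ε ∎
    where
    open ℚP.≤-Reasoning
    J = proj₁ (sumTo-∣approx-ν∣≤half^ (tree m) (app M (num m)) n (adequacy (app M (num m))))
    distance = proj₂ (sumTo-∣approx-ν∣≤half^ (tree m) (app M (num m)) n (adequacy (app M (num m))))

mainTheorem7 : (M : Closed (Nat ⇒ Nat)) →
    Σ (Closed (Nat ⇒ Nat ⇒ Nat ⇒ BIN)) λ F →
    Σ (Closed (Nat ⇒ Nat ⇒ Nat)) λ Q →
    RFree F × RFree Q ×
    Σ (ℕ → ℕ → ℕ → ℕ × ℕ) λ nfF →
    Σ (ℕ → ℕ → ℕ) λ nfQ →
      (∀ m n k → app (app (app F (num m)) (num n)) (num k)
                   ⇓ pair (num (proj₁ (nfF m n k))) (num (proj₂ (nfF m n k)))) ×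
      (∀ m n → app (app Q (num m)) (num n) ⇓ num (nfQ m n)) ×
      ((m n : ℕ) → .{{_ : NonZero n}} →
        ((K : ℕ) (ε : ℚ) → 0ℚ < ε → ∃ λ J → ∀ j → J ≤ℕ j →
           sumTo K (λ k → ∣ approx j (app M (num m)) k
                            - dyadic (proj₁ (nfF m n k)) (proj₂ (nfF m n k)) ∣)
             ≤ (+ 1 / n) + ε) ×
        (∀ k → nfQ m n ≤ℕ k → dyadic (proj₁ (nfF m n k)) (proj₂ (nfF m n k)) ≡ 0ℚ))
mainTheorem7 M =
  embed F , embed Q , embed-RFree F , embed-RFree Q , ⟦ F ⟧ᵀ ∅ᵀ , ⟦ Q ⟧ᵀ ∅ᵀ ,
  evaluate-ℕ³→BIN F , evaluate-ℕ²→ℕ Q , λ m n → F-error m n , F-vanish m n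
  where open Approximants M
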